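{- Let $G$ be the complete graph with self-loops on $n$ vertices (a simple random walk moves at each step to a uniformly chosen vertex among all $n$). Consider the algorithm Hybrid$(G,1)$: run a simple random walk $(X_t)$ from an arbitrary vertex $r$, recording first-entrance edges $\{X_t,X_{t+1}\}$ (those with $X_{t+1}\neq X_k$ for all $k\le t$), until the stopping time $\sigma^{\rm in}_1$, defined as the first time $t$ after the walk first reaches a new vertex at which $X_t\in\{X_0,\dots,X_{t-1}\}$ (capped at the cover time); then run Wilson's algorithm on $G$ with initial condition the tree formed by the visited vertices $\{X_0,\dots,X_{\sigma^{\rm in}_1}\}$ and the recorded edges. Then the expected total number of random walk steps taken by Hybrid$(G,1)$ is $n+\Theta(\sqrt n)$ as $n\to\infty$.
   Context: Wilson's algorithm with initial condition a tree $\tau$: set $V_X=V(\tau)$, $E_X=E(\tau)$; while $V_X\ne V$, choose $v\in V\setminus V_X$ uniformly at random, run a simple random walk from $v$ until it first hits $V_X$, and add the vertices and edges of its chronological loop-erasure to $V_X,E_X$. The steps counted are those of the Aldous-Broder walk up to $\sigma^{\rm in}_1$ plus all random-walk steps made by Wilson's algorithm. -}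

module Defs where

open import Data.Nat as ℕ using (ℕ; zero; suc)
open import Data.Integer using (+_)
open import Data.Rational using (ℚ; _/_; 0ℚ; 1ℚ; _+_; _*_; _-_; _≤_)
open import Data.Fin using (Fin; _≟_)
open import Data.Fin.Subset using (Subset; ⁅_⁆; _∪_; ∣_∣)
open import Data.Vec using (lookup)
open import Data.List using (List; []; _∷_; foldr; map; allFin; filterᵇ; length)
open import Data.Bool using (Bool; true; false; if_then_else_; not)
open import Data.Maybe using (Maybe; just; nothing; maybe′)
open import Data.Product using (_×_)
open import Data.Sum using (_⊎_)
open import Relation.Nullary using (does)
open import Function using (id)

-- The complete graph with self-loops on n = suc m vertices: vertex set
-- Fin (suc m); one SRW step moves to a uniform vertex of Fin (suc m).

ℕ→ℚ : ℕ → ℚ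
ℕ→ℚ k = + k / 1

sumℚ : List ℚ → ℚ
sumℚ = foldr _+_ 0ℚ

-- States of the Hybrid(G,1) algorithm (step counts depend only on
-- vertex sets, edges are not needed to count steps).
data St (n : ℕ) : Set where
  -- Aldous–Broder phase: visited set {X_0..X_t}, current vertex X_t,
  -- flag "a new vertex has already been reached"
  ab         : Subset n → Fin n → Bool → St n
  -- Wilson phase, between walks: current vertex set V_X
  wilsonIdle : Subset n → St n
  -- Wilson phase, during a walk: V_X and the current chronological
  -- loop-erasure of the walk (most recent vertex first)
  wilsonWalk : Subset n → List (Fin n) → St n

-- Kinds of transitions: termination, one counted SRW step (uniform next
-- vertex), or an uncounted uniform choice from a nonempty list.
data Node (n : ℕ) : Set where
  done : Node n
  walk : (Fin n → St n) → Node n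
  pick : St n → List (St n) → Node n

dropTo : ∀ {n} → Fin n → List (Fin n) → Maybe (List (Fin n))
dropTo x [] = nothing
dropTo x (y ∷ ys) = if does (x ≟ y) then just (y ∷ ys) else dropTo x ys

-- chronological loop-erasure, updated when the walk steps to x
erase : ∀ {n} → Fin n → List (Fin n) → List (Fin n)
erase x path = maybe′ id (x ∷ path) (dropTo x path)

addAll : ∀ {n} → Subset n → List (Fin n) → Subset n
addAll V path = foldr (λ x W → W ∪ ⁅ x ⁆) V path

covered : ∀ {n} → Subset n → Bool
covered {n} V = does (∣ V ∣ ℕ.≟ n)

trans : ∀ {n} → St n → Node n
trans (ab vis cur nr) =
  if covered vis
  then pick (wilsonIdle vis) []          -- cover time reached: stop
  else walk (λ x → if lookup vis x
                   then (if nr then wilsonIdle vis   -- time σ^in_1 reached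
                                else ab vis x nr)
                   else ab (vis ∪ ⁅ x ⁆) x true)
trans {n} (wilsonIdle V) with filterᵇ (λ x → not (lookup V x)) (allFin n)
... | [] = done
... | v ∷ vs = pick (wilsonWalk V (v ∷ [])) (map (λ w → wilsonWalk V (w ∷ [])) vs)
trans (wilsonWalk V path) =
  walk (λ x → if lookup V x then wilsonIdle (addAll V path)
              else wilsonWalk V (erase x path))

-- Expected number of counted steps among the first T transitions
-- (uncounted choices also consume one unit of T); the expectation of the
-- total step count is the supremum over T (monotone convergence).
Etrunc : (m : ℕ) → ℕ → St (suc m) → ℚ
Etrunc m zero s = 0ℚ
Etrunc m (suc T) s with trans s
... | done = 0ℚ
... | walk f = 1ℚ + (+ 1 / suc m) * sumℚ (map (λ x → Etrunc m T (f x)) (allFin (suc m)))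
... | pick s₀ ss = (+ 1 / suc (length ss)) * sumℚ (map (Etrunc m T) (s₀ ∷ ss))

init : ∀ {n} → Fin n → St n
init r = ab ⁅ r ⁆ r false

-- x ≤ c·√k   (for c ≥ 0)
LeCSqrt : ℚ → ℚ → ℕ → Set
LeCSqrt x c k = x ≤ 0ℚ ⊎ (x * x ≤ c * c * ℕ→ℚ k)

-- c·√k ≤ x   (for c ≥ 0)
GeCSqrt : ℚ → ℚ → ℕ → Set
GeCSqrt x c k = 0ℚ ≤ x × (c * c * ℕ→ℚ k ≤ x * x)

-- The complete graph is symmetric, so the truncated expectation Etrunc depends on a state
-- only through a few counts: the number of visited vertices and the flag in the
-- Aldous–Broder phase, the size of the tree V_X between Wilson walks, and in addition the
-- length of the loop erasure during a walk.  These counts form a Markov chain with rewards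
-- (the counted steps), whose truncated values lie below every nonnegative supersolution of
-- its Bellman equation and above every subsolution minus a slowly decaying multiple of a
-- Lyapunov function.  From a tree with k vertices Wilson's algorithm needs (N - k)(k + 1)/k
-- further steps in expectation; writing the value of the Aldous–Broder state with j visited
-- vertices as N - j + h_j, the Bellman equation becomes N h_j = N + (N - j) h_{j+1}.  For
-- s = ⌊√N⌋ the functions s + 2 + (2s ∸ j) and (s ∸ j)/2 are a super- and a subsolution of
-- this recursion, whence (s ∸ 6)/2 ≤ E - N ≤ 3s once N ≥ 144.

module Submission where

open import Data.Bool using (Bool; true; false; if_then_else_; not; T?) renaming (T to True)
open import Data.Bool.Properties using (not-injective; not-¬; T-not-≡)
open import Data.Empty using (⊥-elim)
open import Data.Fin using (Fin; zero; suc)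
import Data.Fin.Properties as Fin
open import Data.Fin.Subset using (Subset; ⁅_⁆; _∪_; ∣_∣)
open import Data.Fin.Subset.Properties using (∣⁅x⁆∣≡1; ∣p∣≤n; ∪-identityʳ)
import Data.Integer as ℤ
import Data.Integer.Properties as ℤ
open import Data.List using (List; []; _∷_; map; allFin; tabulate; filterᵇ; length)
open import Data.List.Properties using (map-tabulate; map-cong)
open import Data.List.Relation.Unary.All as All using (All; []; _∷_)
open import Data.List.Relation.Unary.All.Properties using (all-filter)
open import Data.List.Relation.Unary.AllPairs as AllPairs using ([]; _∷_)
open import Data.List.Relation.Unary.Unique.Propositional using (Unique)
open import Data.Maybe using (just; nothing; maybe′)
open import Data.Nat as ℕ using (ℕ; zero; suc; z≤n; s≤s; _≥_)
import Data.Nat.Properties as ℕ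
import Data.Nat.Tactic.RingSolver as ℕ-Solver
open import Data.Product using (Σ; ∃; _×_; _,_; proj₁; proj₂)
open import Data.Rational
  using (ℚ; 0ℚ; 1ℚ; _+_; _*_; _-_; -_; _≤_; _<_; _/_; *≤*; toℚᵘ; nonNegative; positive)
open import Data.Rational.Properties
  using ( _≟_; +-*-commutativeRing; toℚᵘ-injective; toℚᵘ-fromℚᵘ; toℚᵘ-homo-+; toℚᵘ-homo-*
        ; toℚᵘ-cancel-≤; ≤-refl; ≤-reflexive; <⇒≤; ≤-trans; ≤-total; +-mono-≤; +-monoˡ-≤; +-monoʳ-≤
        ; neg-antimono-≤; *-monoˡ-≤-nonNeg; *-monoʳ-≤-nonNeg; *-zeroˡ; *-zeroʳ; *-comm; +-comm; +-assoc; *-identityˡ; *-identityʳ; +-identityʳ; +-inverseʳ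
        ; nonNegative⁻¹; positive⁻¹; nonNeg*nonNeg⇒nonNeg; pos*pos⇒pos; normalize-nonNeg; normalize-pos
        ; module ≤-Reasoning)
import Data.Rational.Unnormalised as ℚᵘ
import Data.Rational.Unnormalised.Properties as ℚᵘ
open import Data.Sum using (_⊎_; inj₁; inj₂)
open import Data.Unit using (⊤; tt)
open import Data.Vec using ([]; _∷_; lookup)
open import Function using (_∘_; id; Equivalence)
open import Level using (0ℓ)
open import Relation.Binary.PropositionalEquality hiding (trans; J)
import Relation.Binary.PropositionalEquality as ≡
open import Relation.Nullary using (Dec; does; yes; no)
open import Relation.Nullary.Decidable using (dec-true; dec-false; dec⇒maybe)
open import Tactic.RingSolver using (solve-∀)
open import Tactic.RingSolver.Core.AlmostCommutativeRing using (AlmostCommutativeRing; fromCommutativeRing)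

open import Defs

ℚ-ring : AlmostCommutativeRing 0ℓ 0ℓ
ℚ-ring = fromCommutativeRing +-*-commutativeRing (dec⇒maybe ∘ (0ℚ ≟_))

toℚᵘ-/ : ∀ k d → toℚᵘ (ℤ.+ k / suc d) ℚᵘ.≃ ℚᵘ.mkℚᵘ (ℤ.+ k) d
toℚᵘ-/ k d = toℚᵘ-fromℚᵘ (ℚᵘ.mkℚᵘ (ℤ.+ k) d)

ℕ→ℚ-homo-+ : ∀ a b → ℕ→ℚ (a ℕ.+ b) ≡ ℕ→ℚ a + ℕ→ℚ b
ℕ→ℚ-homo-+ a b = toℚᵘ-injective (begin
  toℚᵘ (ℕ→ℚ (a ℕ.+ b))                   ≈⟨ toℚᵘ-/ (a ℕ.+ b) 0 ⟩
  ℚᵘ.mkℚᵘ (ℤ.+ (a ℕ.+ b)) 0               ≈⟨ ℚᵘ.*≡* (cong (ℤ._* ℤ.+ 1) (cong₂ ℤ._+_ (a≡a*1 a) (a≡a*1 b))) ⟩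
  ℚᵘ.mkℚᵘ (ℤ.+ a) 0 ℚᵘ.+ ℚᵘ.mkℚᵘ (ℤ.+ b) 0  ≈⟨ ℚᵘ.+-cong (toℚᵘ-/ a 0) (toℚᵘ-/ b 0) ⟨
  toℚᵘ (ℕ→ℚ a) ℚᵘ.+ toℚᵘ (ℕ→ℚ b)          ≈⟨ toℚᵘ-homo-+ (ℕ→ℚ a) (ℕ→ℚ b) ⟨
  toℚᵘ (ℕ→ℚ a + ℕ→ℚ b)                    ∎)
  where
  open ℚᵘ.≃-Reasoning
  a≡a*1 : ∀ a → ℤ.+ a ≡ ℤ.+ a ℤ.* ℤ.+ 1
  a≡a*1 a = sym (ℤ.*-identityʳ (ℤ.+ a))

ℕ→ℚ-homo-* : ∀ a b → ℕ→ℚ (a ℕ.* b) ≡ ℕ→ℚ a * ℕ→ℚ b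
ℕ→ℚ-homo-* a b = toℚᵘ-injective (begin
  toℚᵘ (ℕ→ℚ (a ℕ.* b))                   ≈⟨ toℚᵘ-/ (a ℕ.* b) 0 ⟩
  ℚᵘ.mkℚᵘ (ℤ.+ (a ℕ.* b)) 0               ≈⟨ ℚᵘ.*≡* (cong (ℤ._* ℤ.+ 1) (ℤ.pos-* a b)) ⟩
  ℚᵘ.mkℚᵘ (ℤ.+ a) 0 ℚᵘ.* ℚᵘ.mkℚᵘ (ℤ.+ b) 0  ≈⟨ ℚᵘ.*-cong (toℚᵘ-/ a 0) (toℚᵘ-/ b 0) ⟨
  toℚᵘ (ℕ→ℚ a) ℚᵘ.* toℚᵘ (ℕ→ℚ b)          ≈⟨ toℚᵘ-homo-* (ℕ→ℚ a) (ℕ→ℚ b) ⟨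
  toℚᵘ (ℕ→ℚ a * ℕ→ℚ b)                    ∎)
  where open ℚᵘ.≃-Reasoning

ℕ→ℚ-mono-≤ : ∀ {a b} → a ℕ.≤ b → ℕ→ℚ a ≤ ℕ→ℚ b
ℕ→ℚ-mono-≤ {a} {b} a≤b = toℚᵘ-cancel-≤ (ℚᵘ.≤-respʳ-≃ (ℚᵘ.≃-sym (toℚᵘ-/ b 0)) (ℚᵘ.≤-respˡ-≃ (ℚᵘ.≃-sym (toℚᵘ-/ a 0))
  (ℚᵘ.*≤* (subst₂ ℤ._≤_ (sym (ℤ.*-identityʳ (ℤ.+ a))) (sym (ℤ.*-identityʳ (ℤ.+ b))) (ℤ.+≤+ a≤b)))))

ℕ→ℚ-suc : ∀ k → ℕ→ℚ (suc k) ≡ 1ℚ + ℕ→ℚ k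
ℕ→ℚ-suc = ℕ→ℚ-homo-+ 1

ℕ→ℚ-nonNeg : ∀ k → 0ℚ ≤ ℕ→ℚ k
ℕ→ℚ-nonNeg k = ℕ→ℚ-mono-≤ {b = k} z≤n

ℕ→ℚ-pos : ∀ k → 0ℚ < ℕ→ℚ (suc k)
ℕ→ℚ-pos k = positive⁻¹ (ℕ→ℚ (suc k)) {{normalize-pos (suc k) 1}}

1/ℕ : ℕ → ℚ
1/ℕ zero    = 0ℚ
1/ℕ (suc k) = ℤ.+ 1 / suc k

1/ℕ-inverseʳ : ∀ k → ℕ→ℚ (suc k) * 1/ℕ (suc k) ≡ 1ℚ
1/ℕ-inverseʳ k = toℚᵘ-injective (begin
  toℚᵘ (ℕ→ℚ (suc k) * 1/ℕ (suc k))            ≈⟨ toℚᵘ-homo-* (ℕ→ℚ (suc k)) (1/ℕ (suc k)) ⟩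
  toℚᵘ (ℕ→ℚ (suc k)) ℚᵘ.* toℚᵘ (1/ℕ (suc k))  ≈⟨ ℚᵘ.*-cong (toℚᵘ-/ (suc k) 0) (toℚᵘ-/ 1 k) ⟩
  ℚᵘ.mkℚᵘ (ℤ.+ suc k) 0 ℚᵘ.* ℚᵘ.mkℚᵘ (ℤ.+ 1) k  ≈⟨ ℚᵘ.*≡* (cong (λ x → ℤ.+ suc x) (k*1*1≡k+0+0 k)) ⟩
  ℚᵘ.1ℚᵘ                                       ∎)
  where
  open ℚᵘ.≃-Reasoning
  k*1*1≡k+0+0 : ∀ k → k ℕ.* 1 ℕ.* 1 ≡ k ℕ.+ 0 ℕ.+ 0
  k*1*1≡k+0+0 = ℕ-Solver.solve-∀

1/ℕ-nonNeg : ∀ k → 0ℚ ≤ 1/ℕ k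
1/ℕ-nonNeg zero    = ≤-refl
1/ℕ-nonNeg (suc k) = nonNegative⁻¹ (1/ℕ (suc k)) {{normalize-nonNeg 1 (suc k)}}

1/ℕ-≤-1 : ∀ k → 1/ℕ k ≤ 1ℚ
1/ℕ-≤-1 zero    = ℕ→ℚ-nonNeg 1
1/ℕ-≤-1 (suc k) = begin
  1/ℕ (suc k)                  ≡⟨ *-identityˡ (1/ℕ (suc k)) ⟨
  1ℚ * 1/ℕ (suc k)             ≤⟨ *-monoʳ-≤-nonNeg (1/ℕ (suc k)) {{nonNegative (1/ℕ-nonNeg (suc k))}} (ℕ→ℚ-mono-≤ {b = suc k} (s≤s z≤n)) ⟩
  ℕ→ℚ (suc k) * 1/ℕ (suc k)    ≡⟨ 1/ℕ-inverseʳ k ⟩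
  1ℚ                           ∎
  where open ≤-Reasoning

ℕ→ℚ-homo-∸ : ∀ {a b} → b ℕ.≤ a → ℕ→ℚ (a ℕ.∸ b) ≡ ℕ→ℚ a - ℕ→ℚ b
ℕ→ℚ-homo-∸ {a} {b} b≤a = begin
  ℕ→ℚ (a ℕ.∸ b)                     ≡⟨ add-sub (ℕ→ℚ (a ℕ.∸ b)) (ℕ→ℚ b) ⟨
  ℕ→ℚ (a ℕ.∸ b) + ℕ→ℚ b - ℕ→ℚ b     ≡⟨ cong (_- ℕ→ℚ b) (ℕ→ℚ-homo-+ (a ℕ.∸ b) b) ⟨
  ℕ→ℚ (a ℕ.∸ b ℕ.+ b) - ℕ→ℚ b       ≡⟨ cong (λ c → ℕ→ℚ c - ℕ→ℚ b) (ℕ.m∸n+n≡m b≤a) ⟩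
  ℕ→ℚ a - ℕ→ℚ b                     ∎
  where
  open ≡-Reasoning
  add-sub : ∀ x y → x + y - y ≡ x
  add-sub = solve-∀ ℚ-ring

*-monoˡ-≤-nonNeg′ : ∀ {r p q} → 0ℚ ≤ r → p ≤ q → r * p ≤ r * q
*-monoˡ-≤-nonNeg′ {r} 0≤r = *-monoˡ-≤-nonNeg r {{nonNegative 0≤r}}

*-pos : ∀ {p q} → 0ℚ < p → 0ℚ < q → 0ℚ < p * q
*-pos {p} {q} 0<p 0<q = positive⁻¹ (p * q) {{pos*pos⇒pos p {{positive 0<p}} q {{positive 0<q}}}}

*-nonNeg : ∀ {p q} → 0ℚ ≤ p → 0ℚ ≤ q → 0ℚ ≤ p * q
*-nonNeg {p} {q} 0≤p 0≤q = nonNegative⁻¹ (p * q) {{nonNeg*nonNeg⇒nonNeg p {{nonNegative 0≤p}} q {{nonNegative 0≤q}}}}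

p≤q⇒0≤q-p : ∀ {p q} → p ≤ q → 0ℚ ≤ q - p
p≤q⇒0≤q-p {p} {q} p≤q = subst (_≤ q - p) (+-inverseʳ p) (+-monoˡ-≤ (- p) p≤q)

sub-mono-≤ : ∀ {a b d e} → a ≤ b → d ≤ e → a - e ≤ b - d
sub-mono-≤ a≤b d≤e = +-mono-≤ a≤b (neg-antimono-≤ d≤e)

≤-by-slack : ∀ {a b} e → b ≡ a + e → 0ℚ ≤ e → a ≤ b
≤-by-slack {a} {b} e b≡a+e 0≤e = begin
  a       ≡⟨ +-identityʳ a ⟨
  a + 0ℚ  ≤⟨ +-monoʳ-≤ a 0≤e ⟩
  a + e   ≡⟨ b≡a+e ⟨
  b       ∎
  where open ≤-Reasoning

p-q≤p : ∀ p {q} → 0ℚ ≤ q → p - q ≤ p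
p-q≤p p {q} 0≤q = ≤-by-slack q (restore p q) 0≤q
  where
  restore : ∀ p q → p ≡ p - q + q
  restore = solve-∀ ℚ-ring

a+b≤c⇒b≤c-a : ∀ {a b c} → a + b ≤ c → b ≤ c - a
a+b≤c⇒b≤c-a {a} {b} {c} a+b≤c = ≤-by-slack (c - (a + b)) (regroup a b c) (p≤q⇒0≤q-p a+b≤c)
  where
  regroup : ∀ a b c → c - a ≡ b + (c - (a + b))
  regroup = solve-∀ ℚ-ring

square-mono-≤ : ∀ {x y} → 0ℚ ≤ x → x ≤ y → x * x ≤ y * y
square-mono-≤ {x} {y} 0≤x x≤y = ≤-trans (*-monoˡ-≤-nonNeg′ 0≤x x≤y) (*-monoʳ-≤-nonNeg y {{nonNegative (≤-trans 0≤x x≤y)}} x≤y)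

a≤b+c⇒a-b≤c : ∀ {a b c} → a ≤ b + c → a - b ≤ c
a≤b+c⇒a-b≤c {a} {b} {c} a≤b+c = ≤-trans (+-monoˡ-≤ (- b) a≤b+c) (≤-reflexive (cancel b c))
  where
  cancel : ∀ b c → b + c - b ≡ c
  cancel = solve-∀ ℚ-ring

-- Identities that hold modulo d = 1, typically d = k · 1/ℕ k, are proved in this form.
≡-modulo-unit : ∀ {a b d} u → d ≡ 1ℚ → a ≡ b + u * (d - 1ℚ) → a ≡ b
≡-modulo-unit {b = b} u refl a≡b+u*0 = ≡.trans a≡b+u*0 (vanish b u)
  where
  vanish : ∀ b u → b + u * (1ℚ - 1ℚ) ≡ b
  vanish = solve-∀ ℚ-ring

*-cancel-inverse : ∀ {i k} c → k * i ≡ 1ℚ → i * (k * c) ≡ c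
*-cancel-inverse {i} {k} c k*i≡1 = ≡-modulo-unit c k*i≡1 (expand i k c)
  where
  expand : ∀ i k c → i * (k * c) ≡ c + c * (k * i - 1ℚ)
  expand = solve-∀ ℚ-ring

½ : ℚ
½ = 1/ℕ 2

½-inverseˡ : ½ * ℕ→ℚ 2 ≡ 1ℚ
½-inverseˡ = ≡.trans (*-comm ½ (ℕ→ℚ 2)) (1/ℕ-inverseʳ 1)

½-nonNeg : 0ℚ ≤ ½
½-nonNeg = 1/ℕ-nonNeg 2

½-pos : 0ℚ < ½
½-pos = positive⁻¹ ½ {{normalize-pos 1 2}}

½-≤-1 : ½ ≤ 1ℚ
½-≤-1 = 1/ℕ-≤-1 2

decay : ℕ → ℕ → ℚ
decay M T = ℕ→ℚ (suc M) * 1/ℕ (suc (T ℕ.+ M))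

decay-zero : ∀ M → decay M 0 ≡ 1ℚ
decay-zero = 1/ℕ-inverseʳ

decay-nonNeg : ∀ M T → 0ℚ ≤ decay M T
decay-nonNeg M T = *-nonNeg (ℕ→ℚ-nonNeg (suc M)) (1/ℕ-nonNeg (suc (T ℕ.+ M)))

decay-step : ∀ M T {φ a} → 1ℚ + a ≤ φ → φ ≤ ℕ→ℚ M → decay M T * a ≤ decay M (suc T) * φ
decay-step M T {φ} {a} 1+a≤φ φ≤M = begin
  c * i * a              ≤⟨ *-monoˡ-≤-nonNeg′ (decay-nonNeg M T) (a+b≤c⇒b≤c-a {1ℚ} 1+a≤φ) ⟩
  c * i * (φ - 1ℚ)       ≤⟨ ≤-by-slack (c * i * i′ * (1ℚ + y - φ)) identity (*-nonNeg (*-nonNeg (decay-nonNeg M T) i′≥0) slack) ⟩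
  c * i′ * φ             ∎
  where
  open ≤-Reasoning
  c = ℕ→ℚ (suc M)
  y = ℕ→ℚ (suc (T ℕ.+ M))
  i = 1/ℕ (suc (T ℕ.+ M))
  i′ = 1/ℕ (suc (suc (T ℕ.+ M)))
  i′≥0 : 0ℚ ≤ i′
  i′≥0 = 1/ℕ-nonNeg (suc (suc (T ℕ.+ M)))
  expand : ∀ c i i′ y φ → c * i′ * φ ≡ c * i * (φ - 1ℚ) + c * i * i′ * (1ℚ + y - φ)
                                        + c * i * (φ - 1ℚ) * ((1ℚ + y) * i′ - 1ℚ) + (- (c * φ * i′)) * (y * i - 1ℚ)
  expand = solve-∀ ℚ-ring
  identity : c * i′ * φ ≡ c * i * (φ - 1ℚ) + c * i * i′ * (1ℚ + y - φ)
  identity = ≡-modulo-unit (c * i * (φ - 1ℚ)) (≡.trans (cong (_* i′) (sym (ℕ→ℚ-suc (suc (T ℕ.+ M))))) (1/ℕ-inverseʳ (suc (T ℕ.+ M))))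
    (≡-modulo-unit (- (c * φ * i′)) (1/ℕ-inverseʳ (T ℕ.+ M)) (expand c i i′ y φ))
  slack : 0ℚ ≤ 1ℚ + y - φ
  slack = p≤q⇒0≤q-p (≤-trans φ≤M (≤-trans (ℕ→ℚ-mono-≤ M≤2+T+M) (≤-reflexive (ℕ→ℚ-suc (suc (T ℕ.+ M))))))
    where
    M≤2+T+M : M ℕ.≤ suc (suc (T ℕ.+ M))
    M≤2+T+M = ℕ.≤-trans (ℕ.m≤n+m M T) (ℕ.≤-trans (ℕ.n≤1+n _) (ℕ.n≤1+n _))

decay-≤-1 : ∀ M T {φ} → M ℕ.* M ℕ.≤ T → φ ≤ ℕ→ℚ M → decay M T * φ ≤ 1ℚ
decay-≤-1 M T {φ} M²≤T φ≤M = begin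
  ℕ→ℚ (suc M) * i * φ              ≤⟨ *-monoˡ-≤-nonNeg′ (decay-nonNeg M T) φ≤M ⟩
  ℕ→ℚ (suc M) * i * ℕ→ℚ M          ≡⟨ swap (ℕ→ℚ (suc M)) i (ℕ→ℚ M) ⟩
  ℕ→ℚ (suc M) * ℕ→ℚ M * i          ≡⟨ cong (_* i) (ℕ→ℚ-homo-* (suc M) M) ⟨
  ℕ→ℚ (suc M ℕ.* M) * i            ≤⟨ *-monoʳ-≤-nonNeg i {{nonNegative (1/ℕ-nonNeg (suc (T ℕ.+ M)))}} (ℕ→ℚ-mono-≤ M+M²≤1+T+M) ⟩
  ℕ→ℚ (suc (T ℕ.+ M)) * i          ≡⟨ 1/ℕ-inverseʳ (T ℕ.+ M) ⟩
  1ℚ                               ∎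
  where
  open ≤-Reasoning
  i = 1/ℕ (suc (T ℕ.+ M))
  swap : ∀ a b c → a * b * c ≡ a * c * b
  swap = solve-∀ ℚ-ring
  M+M²≤1+T+M : suc M ℕ.* M ℕ.≤ suc (T ℕ.+ M)
  M+M²≤1+T+M = ℕ.≤-trans (ℕ.≤-reflexive (ℕ.+-comm M (M ℕ.* M))) (ℕ.≤-trans (ℕ.+-monoˡ-≤ M M²≤T) (ℕ.n≤1+n _))

-- Values of a Markov chain with rewards

-- A move of weight zero may lead outside the valid states.
Admissible : {X : Set} → (X → Set) → ℚ × X → Set
Admissible Valid (w , y) = 0ℚ ≤ w × (w ≡ 0ℚ ⊎ Valid y)

expect : {X : Set} → List (ℚ × X) → (X → ℚ) → ℚ
expect []             f = 0ℚ
expect ((w , y) ∷ ws) f = w * f y + expect ws f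

module _ {X : Set} where

  expect-linear : ∀ ws (f g : X → ℚ) c → expect ws (λ y → f y - c * g y) ≡ expect ws f - c * expect ws g
  expect-linear []             f g c = zero-linear c
    where
    zero-linear : ∀ c → 0ℚ ≡ 0ℚ - c * 0ℚ
    zero-linear = solve-∀ ℚ-ring
  expect-linear ((w , y) ∷ ws) f g c = begin
    w * (f y - c * g y) + expect ws (λ y → f y - c * g y)      ≡⟨ cong (w * (f y - c * g y) +_) (expect-linear ws f g c) ⟩
    w * (f y - c * g y) + (expect ws f - c * expect ws g)      ≡⟨ regroup w (f y) (g y) c (expect ws f) (expect ws g) ⟩
    w * f y + expect ws f - c * (w * g y + expect ws g)        ∎
    where
    open ≡-Reasoning
    regroup : ∀ w a b c s t → w * (a - c * b) + (s - c * t) ≡ w * a + s - c * (w * b + t)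
    regroup = solve-∀ ℚ-ring

  expect-+ : ∀ ws (f g : X → ℚ) → expect ws (λ y → f y + g y) ≡ expect ws f + expect ws g
  expect-+ []             f g = refl
  expect-+ ((w , y) ∷ ws) f g = begin
    w * (f y + g y) + expect ws (λ y → f y + g y)      ≡⟨ cong (w * (f y + g y) +_) (expect-+ ws f g) ⟩
    w * (f y + g y) + (expect ws f + expect ws g)      ≡⟨ regroup w (f y) (g y) (expect ws f) (expect ws g) ⟩
    w * f y + expect ws f + (w * g y + expect ws g)    ∎
    where
    open ≡-Reasoning
    regroup : ∀ w a b s t → w * (a + b) + (s + t) ≡ w * a + s + (w * b + t)
    regroup = solve-∀ ℚ-ring

  module _ {Valid : X → Set} where

    expect-mono : ∀ {f g : X → ℚ} ws → All (Admissible Valid) ws →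
                  (∀ y → Valid y → f y ≤ g y) → expect ws f ≤ expect ws g
    expect-mono []                  []                       f≤g = ≤-refl
    expect-mono {f} {g} ((w , y) ∷ ws) ((_ , inj₁ refl) ∷ adm) f≤g =
      +-mono-≤ (≤-reflexive (≡.trans (*-zeroˡ (f y)) (sym (*-zeroˡ (g y))))) (expect-mono ws adm f≤g)
    expect-mono ((w , y) ∷ ws) ((0≤w , inj₂ valid) ∷ adm) f≤g =
      +-mono-≤ (*-monoˡ-≤-nonNeg′ 0≤w (f≤g y valid)) (expect-mono ws adm f≤g)

module MarkovValue {X : Set} (reward : X → ℚ) (moves : X → List (ℚ × X)) where

  bellman : (X → ℚ) → X → ℚ
  bellman f x = reward x + expect (moves x) f

  value : ℕ → X → ℚ
  value zero    x = 0ℚ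
  value (suc T) x = bellman (value T) x

  module Comparison (Valid : X → Set) (moves-admissible : ∀ x → Valid x → All (Admissible Valid) (moves x)) where

    Supersolution : (X → ℚ) → Set
    Supersolution U = ∀ x → Valid x → bellman U x ≤ U x

    Subsolution : (X → ℚ) → Set
    Subsolution L = ∀ x → Valid x → L x ≤ bellman L x

    record Lyapunov (Φ : X → ℚ) (M : ℕ) : Set where
      field
        drift   : ∀ x → Valid x → 1ℚ + expect (moves x) Φ ≤ Φ x
        bounded : ∀ x → Valid x → Φ x ≤ ℕ→ℚ M

    bellman-mono : ∀ {f g} x → Valid x → (∀ y → Valid y → f y ≤ g y) → bellman f x ≤ bellman g x
    bellman-mono x valid f≤g = +-monoʳ-≤ (reward x) (expect-mono (moves x) (moves-admissible x valid) f≤g)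

    value≤supersolution : ∀ {U} → (∀ x → Valid x → 0ℚ ≤ U x) → Supersolution U →
                          ∀ T x → Valid x → value T x ≤ U x
    value≤supersolution U≥0 super zero    x valid = U≥0 x valid
    value≤supersolution U≥0 super (suc T) x valid =
      ≤-trans (bellman-mono x valid (value≤supersolution U≥0 super T)) (super x valid)

    subsolution-decay≤value : ∀ {L Φ M} → Subsolution L → Lyapunov Φ M → (∀ x → Valid x → L x ≤ Φ x) →
                              ∀ T x → Valid x → L x - decay M T * Φ x ≤ value T x
    subsolution-decay≤value {L} {Φ} {M} sub lyap L≤Φ = go
      where
      open Lyapunov lyap
      go : ∀ T x → Valid x → L x - decay M T * Φ x ≤ value T x
      go zero x valid = begin
        L x - decay M 0 * Φ x   ≡⟨ cong (λ d → L x - d * Φ x) (decay-zero M) ⟩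
        L x - 1ℚ * Φ x          ≤⟨ sub-mono-≤ (L≤Φ x valid) (≤-reflexive (sym (*-identityˡ (Φ x)))) ⟩
        Φ x - Φ x               ≡⟨ +-inverseʳ (Φ x) ⟩
        0ℚ                      ∎
        where open ≤-Reasoning
      go (suc T) x valid = begin
        L x - decay M (suc T) * Φ x
          ≤⟨ sub-mono-≤ (sub x valid) (decay-step M T (drift x valid) (bounded x valid)) ⟩
        bellman L x - decay M T * expect (moves x) Φ
          ≡⟨ regroup (reward x) (expect (moves x) L) (decay M T * expect (moves x) Φ) ⟩
        reward x + (expect (moves x) L - decay M T * expect (moves x) Φ)
          ≡⟨ cong (reward x +_) (expect-linear (moves x) L Φ (decay M T)) ⟨
        bellman (λ y → L y - decay M T * Φ y) x
          ≤⟨ bellman-mono x valid (go T) ⟩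
        value (suc T) x ∎
        where
        open ≤-Reasoning
        regroup : ∀ r e d → r + e - d ≡ r + (e - d)
        regroup = solve-∀ ℚ-ring

    supersolution-+ : ∀ {U u} → Supersolution U → (∀ x → Valid x → 1ℚ - reward x + expect (moves x) u ≤ u x) →
                      ∀ x → Valid x → 1ℚ + expect (moves x) (λ y → U y + u y) ≤ U x + u x
    supersolution-+ {U} {u} super u-super x valid = begin
      1ℚ + expect (moves x) (λ y → U y + u y)               ≡⟨ cong (1ℚ +_) (expect-+ (moves x) U u) ⟩
      1ℚ + (expect (moves x) U + expect (moves x) u)        ≡⟨ split (reward x) (expect (moves x) U) (expect (moves x) u) ⟩
      bellman U x + (1ℚ - reward x + expect (moves x) u)    ≤⟨ +-mono-≤ (super x valid) (u-super x valid) ⟩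
      U x + u x                                             ∎
      where
      open ≤-Reasoning
      split : ∀ r a b → 1ℚ + (a + b) ≡ r + a + (1ℚ - r + b)
      split = solve-∀ ℚ-ring

sumFin : (n : ℕ) → (Fin n → ℚ) → ℚ
sumFin n f = sumℚ (map f (allFin n))

sumFin-suc : ∀ n (f : Fin (suc n) → ℚ) → sumFin (suc n) f ≡ f zero + sumFin n (f ∘ suc)
sumFin-suc n f = cong (λ xs → f zero + sumℚ xs) (≡.trans (map-tabulate suc f) (sym (map-tabulate id (f ∘ suc))))

sumFin-cong : ∀ n {f g : Fin n → ℚ} → (∀ x → f x ≡ g x) → sumFin n f ≡ sumFin n g
sumFin-cong n f≗g = cong sumℚ (map-cong f≗g (allFin n))

sumFin-indicator : ∀ {n} (V : Subset n) a b →
                   sumFin n (λ x → if lookup V x then a else b) ≡ ℕ→ℚ ∣ V ∣ * a + (ℕ→ℚ n - ℕ→ℚ ∣ V ∣) * b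
sumFin-indicator [] a b = empty a b
  where
  empty : ∀ a b → 0ℚ ≡ 0ℚ * a + (0ℚ - 0ℚ) * b
  empty = solve-∀ ℚ-ring
sumFin-indicator {suc n} (true ∷ V) a b = begin
  sumFin (suc n) (λ x → if lookup (true ∷ V) x then a else b)  ≡⟨ sumFin-suc n (λ x → if lookup (true ∷ V) x then a else b) ⟩
  a + sumFin n (λ x → if lookup V x then a else b)             ≡⟨ cong (a +_) (sumFin-indicator V a b) ⟩
  a + (v * a + (k - v) * b)                                     ≡⟨ count-in v k a b ⟩
  (1ℚ + v) * a + (1ℚ + k - (1ℚ + v)) * b                        ≡⟨ cong₂ (λ v′ k′ → v′ * a + (k′ - v′) * b) (ℕ→ℚ-suc ∣ V ∣) (ℕ→ℚ-suc n) ⟨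
  ℕ→ℚ (suc ∣ V ∣) * a + (ℕ→ℚ (suc n) - ℕ→ℚ (suc ∣ V ∣)) * b   ∎
  where
  open ≡-Reasoning
  v = ℕ→ℚ ∣ V ∣
  k = ℕ→ℚ n
  count-in : ∀ v k a b → a + (v * a + (k - v) * b) ≡ (1ℚ + v) * a + (1ℚ + k - (1ℚ + v)) * b
  count-in = solve-∀ ℚ-ring
sumFin-indicator {suc n} (false ∷ V) a b = begin
  sumFin (suc n) (λ x → if lookup (false ∷ V) x then a else b)  ≡⟨ sumFin-suc n (λ x → if lookup (false ∷ V) x then a else b) ⟩
  b + sumFin n (λ x → if lookup V x then a else b)              ≡⟨ cong (b +_) (sumFin-indicator V a b) ⟩
  b + (v * a + (k - v) * b)                                      ≡⟨ count-out v k a b ⟩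
  v * a + (1ℚ + k - v) * b                                       ≡⟨ cong (λ k′ → v * a + (k′ - v) * b) (ℕ→ℚ-suc n) ⟨
  v * a + (ℕ→ℚ (suc n) - v) * b                                  ∎
  where
  open ≡-Reasoning
  v = ℕ→ℚ ∣ V ∣
  k = ℕ→ℚ n
  count-out : ∀ v k a b → b + (v * a + (k - v) * b) ≡ v * a + (1ℚ + k - v) * b
  count-out = solve-∀ ℚ-ring

sumFin-update : ∀ n (f g : Fin n → ℚ) y → (∀ x → x ≢ y → f x ≡ g x) → sumFin n f ≡ sumFin n g - g y + f y
sumFin-update (suc n) f g zero f≗g = begin
  sumFin (suc n) f                           ≡⟨ sumFin-suc n f ⟩
  f zero + sumFin n (f ∘ suc)                ≡⟨ cong (f zero +_) (sumFin-cong n (λ x → f≗g (suc x) λ ())) ⟩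
  f zero + sumFin n (g ∘ suc)                ≡⟨ swap-head (f zero) (g zero) (sumFin n (g ∘ suc)) ⟩
  g zero + sumFin n (g ∘ suc) - g zero + f zero ≡⟨ cong (λ s → s - g zero + f zero) (sumFin-suc n g) ⟨
  sumFin (suc n) g - g zero + f zero         ∎
  where
  open ≡-Reasoning
  swap-head : ∀ a b s → a + s ≡ b + s - b + a
  swap-head = solve-∀ ℚ-ring
sumFin-update (suc n) f g (suc y) f≗g = begin
  sumFin (suc n) f                                       ≡⟨ sumFin-suc n f ⟩
  f zero + sumFin n (f ∘ suc)                            ≡⟨ cong₂ _+_ (f≗g zero λ ()) (sumFin-update n (f ∘ suc) (g ∘ suc) y f≗g-suc) ⟩
  g zero + (sumFin n (g ∘ suc) - g (suc y) + f (suc y))  ≡⟨ reassoc (g zero) (sumFin n (g ∘ suc)) (g (suc y)) (f (suc y)) ⟩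
  g zero + sumFin n (g ∘ suc) - g (suc y) + f (suc y)    ≡⟨ cong (λ s → s - g (suc y) + f (suc y)) (sumFin-suc n g) ⟨
  sumFin (suc n) g - g (suc y) + f (suc y)               ∎
  where
  open ≡-Reasoning
  f≗g-suc : ∀ x → x ≢ y → f (suc x) ≡ g (suc x)
  f≗g-suc x x≢y = f≗g (suc x) (x≢y ∘ Fin.suc-injective)
  reassoc : ∀ a s b c → a + (s - b + c) ≡ a + s - b + c
  reassoc = solve-∀ ℚ-ring

sumTo : (ℕ → ℚ) → ℕ → ℚ
sumTo f zero    = 0ℚ
sumTo f (suc l) = sumTo f l + f (suc l)

sumTo-const : ∀ c l → sumTo (λ _ → c) l ≡ ℕ→ℚ l * c
sumTo-const c zero    = sym (*-zeroˡ c)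
sumTo-const c (suc l) = begin
  sumTo (λ _ → c) l + c     ≡⟨ cong (_+ c) (sumTo-const c l) ⟩
  ℕ→ℚ l * c + c             ≡⟨ one-more (ℕ→ℚ l) c ⟩
  (1ℚ + ℕ→ℚ l) * c          ≡⟨ cong (_* c) (ℕ→ℚ-suc l) ⟨
  ℕ→ℚ (suc l) * c           ∎
  where
  open ≡-Reasoning
  one-more : ∀ l c → l * c + c ≡ (1ℚ + l) * c
  one-more = solve-∀ ℚ-ring

lookup-∪⁅x⁆-y : ∀ {n} (W : Subset n) x y → y ≢ x → lookup (W ∪ ⁅ x ⁆) y ≡ lookup W y
lookup-∪⁅x⁆-y (_ ∷ W)     zero    zero    y≢x = ⊥-elim (y≢x refl)
lookup-∪⁅x⁆-y (_ ∷ W)     zero    (suc y) _   = cong (λ U → lookup U y) (∪-identityʳ W)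
lookup-∪⁅x⁆-y (true ∷ W)  (suc x) zero    _   = refl
lookup-∪⁅x⁆-y (false ∷ W) (suc x) zero    _   = refl
lookup-∪⁅x⁆-y (_ ∷ W)     (suc x) (suc y) y≢x = lookup-∪⁅x⁆-y W x y (y≢x ∘ cong suc)

∣W∪⁅x⁆∣ : ∀ {n} (W : Subset n) x → lookup W x ≡ false → ∣ W ∪ ⁅ x ⁆ ∣ ≡ suc ∣ W ∣
∣W∪⁅x⁆∣ (false ∷ W) zero    _   = cong (suc ∘ ∣_∣) (∪-identityʳ W)
∣W∪⁅x⁆∣ (true ∷ W)  (suc x) x∉W = cong suc (∣W∪⁅x⁆∣ W x x∉W)
∣W∪⁅x⁆∣ (false ∷ W) (suc x) x∉W = ∣W∪⁅x⁆∣ W x x∉W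

full⇒∣V∣≡n : ∀ {n} (V : Subset n) → (∀ x → lookup V x ≡ true) → ∣ V ∣ ≡ n
full⇒∣V∣≡n []          _    = refl
full⇒∣V∣≡n (true ∷ V)  full = cong suc (full⇒∣V∣≡n V (full ∘ suc))
full⇒∣V∣≡n (false ∷ V) full with full zero
... | ()

∣V∣≡n⇒full : ∀ {n} (V : Subset n) x → ∣ V ∣ ≡ n → lookup V x ≡ true
∣V∣≡n⇒full (true ∷ V)          zero    _     = refl
∣V∣≡n⇒full (true ∷ V)          (suc x) ∣V∣≡n = ∣V∣≡n⇒full V x (ℕ.suc-injective ∣V∣≡n)
∣V∣≡n⇒full {suc n} (false ∷ V) x       ∣V∣≡n = ⊥-elim (ℕ.<⇒≢ (s≤s (∣p∣≤n V)) ∣V∣≡n)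

filterᵇ≡[] : ∀ {k n} (P : Fin n → Bool) (g : Fin k → Fin n) → filterᵇ P (tabulate g) ≡ [] → ∀ i → P (g i) ≡ false
filterᵇ≡[] {suc k} P g empty i with P (g zero) in Pg₀
filterᵇ≡[] {suc k} P g () i       | true
filterᵇ≡[] {suc k} P g empty zero    | false = Pg₀
filterᵇ≡[] {suc k} P g empty (suc i) | false = filterᵇ≡[] P (g ∘ suc) empty i

dropTo-here : ∀ {n} (y : Fin n) ys → dropTo y (y ∷ ys) ≡ just (y ∷ ys)
dropTo-here y ys rewrite dec-true (y Fin.≟ y) refl = refl

dropTo-there : ∀ {n} {x y : Fin n} ys → x ≢ y → dropTo x (y ∷ ys) ≡ dropTo x ys
dropTo-there {x = x} {y} ys x≢y rewrite dec-false (x Fin.≟ y) x≢y = refl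

dropTo-∉ : ∀ {n} (x : Fin n) ys → All (x ≢_) ys → dropTo x ys ≡ nothing
dropTo-∉ x []       []           = refl
dropTo-∉ x (y ∷ ys) (x≢y ∷ x∉ys) = ≡.trans (dropTo-there ys x≢y) (dropTo-∉ x ys x∉ys)

dropTo-nothing⇒∉ : ∀ {n} (x : Fin n) ys → dropTo x ys ≡ nothing → All (x ≢_) ys
dropTo-nothing⇒∉ x []       _ = []
dropTo-nothing⇒∉ x (y ∷ ys) dropped with x Fin.≟ y
... | no x≢y = x≢y ∷ dropTo-nothing⇒∉ x ys dropped

dropTo-preserves : ∀ {n} {P : List (Fin n) → Set} → (∀ {y ys} → P (y ∷ ys) → P ys) →
                   ∀ x ys {q} → dropTo x ys ≡ just q → P ys → P q
dropTo-preserves P-tail x (y ∷ ys) dropped P-ys with x Fin.≟ y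
dropTo-preserves P-tail x (y ∷ ys) refl    P-ys | yes _ = P-ys
dropTo-preserves P-tail x (y ∷ ys) dropped P-ys | no _  = dropTo-preserves P-tail x ys dropped (P-tail P-ys)

Disjoint : ∀ {n} → Subset n → List (Fin n) → Set
Disjoint V path = All (λ y → lookup V y ≡ false) path

nextValue : ∀ {n} → Subset n → List (Fin n) → ℚ → ℚ → (ℕ → ℚ) → Fin n → ℚ
nextValue V path hit extend erased x = if lookup V x then hit else maybe′ (erased ∘ length) extend (dropTo x path)

sumFin-nextValue : ∀ n (V : Subset n) hit extend erased path → Unique path → Disjoint V path →
                   sumFin n (nextValue V path hit extend erased)
                   ≡ ℕ→ℚ ∣ V ∣ * hit + (ℕ→ℚ n - ℕ→ℚ ∣ V ∣ - ℕ→ℚ (length path)) * extend + sumTo erased (length path)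
sumFin-nextValue n V a b h [] _ _ = ≡.trans (sumFin-indicator V a b) (add-zeros (ℕ→ℚ ∣ V ∣) (ℕ→ℚ n) a b)
  where
  add-zeros : ∀ v k a b → v * a + (k - v) * b ≡ v * a + (k - v - 0ℚ) * b + 0ℚ
  add-zeros = solve-∀ ℚ-ring
sumFin-nextValue n V a b h (y ∷ ys) (y∉ys ∷ ys-unique) (y∉V ∷ ys∩V) = begin
  sumFin n (next (y ∷ ys))
    ≡⟨ sumFin-update n (next (y ∷ ys)) (next ys) y (λ x x≢y → cong (λ d → if lookup V x then a else maybe′ (h ∘ length) b d) (dropTo-there ys x≢y)) ⟩
  sumFin n (next ys) - next ys y + next (y ∷ ys) y
    ≡⟨ cong₂ (λ u w → sumFin n (next ys) - u + w)
             (≡.trans (at-y ys) (cong (maybe′ (h ∘ length) b) (dropTo-∉ y ys y∉ys)))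
             (≡.trans (at-y (y ∷ ys)) (cong (maybe′ (h ∘ length) b) (dropTo-here y ys))) ⟩
  sumFin n (next ys) - b + h (suc l)
    ≡⟨ cong (λ s → s - b + h (suc l)) (sumFin-nextValue n V a b h ys ys-unique ys∩V) ⟩
  v * a + (k - v - ℕ→ℚ l) * b + sumTo h l - b + h (suc l)
    ≡⟨ extend-path v a k b (ℕ→ℚ l) (sumTo h l) (h (suc l)) ⟩
  v * a + (k - v - (1ℚ + ℕ→ℚ l)) * b + (sumTo h l + h (suc l))
    ≡⟨ cong (λ L → v * a + (k - v - L) * b + sumTo h (suc l)) (ℕ→ℚ-suc l) ⟨
  v * a + (k - v - ℕ→ℚ (suc l)) * b + sumTo h (suc l) ∎
  where
  open ≡-Reasoning
  next : List (Fin n) → Fin n → ℚ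
  next path = nextValue V path a b h
  l = length ys
  v = ℕ→ℚ ∣ V ∣
  k = ℕ→ℚ n
  at-y : ∀ path → next path y ≡ maybe′ (h ∘ length) b (dropTo y path)
  at-y path rewrite y∉V = refl
  extend-path : ∀ v a k b L S H → v * a + (k - v - L) * b + S - b + H ≡ v * a + (k - v - (1ℚ + L)) * b + (S + H)
  extend-path = solve-∀ ℚ-ring

lookup-addAll : ∀ {n} (V : Subset n) path z → All (z ≢_) path → lookup (addAll V path) z ≡ lookup V z
lookup-addAll V []       z []           = refl
lookup-addAll V (y ∷ ys) z (z≢y ∷ z∉ys) = ≡.trans (lookup-∪⁅x⁆-y (addAll V ys) y z z≢y) (lookup-addAll V ys z z∉ys)

∣addAll∣ : ∀ {n} (V : Subset n) path → Unique path → Disjoint V path → ∣ addAll V path ∣ ≡ ∣ V ∣ ℕ.+ length path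
∣addAll∣ V []       _                     _             = sym (ℕ.+-identityʳ ∣ V ∣)
∣addAll∣ V (y ∷ ys) (y∉ys ∷ ys-unique) (y∉V ∷ ys∩V) = begin
  ∣ addAll V ys ∪ ⁅ y ⁆ ∣      ≡⟨ ∣W∪⁅x⁆∣ (addAll V ys) y (≡.trans (lookup-addAll V ys y y∉ys) y∉V) ⟩
  suc ∣ addAll V ys ∣          ≡⟨ cong suc (∣addAll∣ V ys ys-unique ys∩V) ⟩
  suc (∣ V ∣ ℕ.+ length ys)    ≡⟨ ℕ.+-suc ∣ V ∣ (length ys) ⟨
  ∣ V ∣ ℕ.+ suc (length ys)    ∎
  where open ≡-Reasoning

m∸n≡1+[m∸1+n] : ∀ {m n} → n ℕ.< m → m ℕ.∸ n ≡ suc (m ℕ.∸ suc n)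
m∸n≡1+[m∸1+n] {suc m} {zero}  _         = refl
m∸n≡1+[m∸1+n] {suc m} {suc n} (s≤s n<m) = m∸n≡1+[m∸1+n] n<m

-- For s = ⌊√n⌋: a supersolution, and twice a subsolution, of n h_j = n + (n ∸ j) h_{j+1}.
upperExcess : ℕ → ℕ → ℕ
upperExcess s j = s ℕ.+ 2 ℕ.+ (2 ℕ.* s ℕ.∸ j)

lowerExcess : ℕ → ℕ → ℕ
lowerExcess s j = s ℕ.∸ j

upperExcess-step : ∀ {n s} j → n ℕ.≤ s ℕ.* s ℕ.+ 2 ℕ.* s → j ℕ.≤ n →
                   n ℕ.+ (n ℕ.∸ j) ℕ.* upperExcess s (suc j) ℕ.≤ n ℕ.* upperExcess s j
upperExcess-step {n} {s} j n≤s²+2s j≤n with j ℕ.<? 2 ℕ.* s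
... | yes j<2s = begin
  n ℕ.+ (n ℕ.∸ j) ℕ.* h′   ≤⟨ ℕ.+-monoʳ-≤ n (ℕ.*-monoˡ-≤ h′ (ℕ.m∸n≤m n j)) ⟩
  n ℕ.+ n ℕ.* h′           ≡⟨ ℕ.*-suc n h′ ⟨
  n ℕ.* suc h′             ≡⟨ cong (n ℕ.*_) (≡.trans (cong (s ℕ.+ 2 ℕ.+_) (m∸n≡1+[m∸1+n] j<2s)) (ℕ.+-suc (s ℕ.+ 2) _)) ⟨
  n ℕ.* upperExcess s j    ∎
  where
  open ℕ.≤-Reasoning
  h′ = upperExcess s (suc j)
... | no j≮2s = begin
  n ℕ.+ (n ℕ.∸ j) ℕ.* upperExcess s (suc j)  ≡⟨ cong (λ d → n ℕ.+ (n ℕ.∸ j) ℕ.* (s ℕ.+ 2 ℕ.+ d)) (ℕ.m≤n⇒m∸n≡0 (ℕ.m≤n⇒m≤1+n 2s≤j)) ⟩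
  n ℕ.+ (n ℕ.∸ j) ℕ.* H                      ≤⟨ ℕ.+-monoˡ-≤ ((n ℕ.∸ j) ℕ.* H) n≤jH ⟩
  j ℕ.* H ℕ.+ (n ℕ.∸ j) ℕ.* H                ≡⟨ ℕ.*-distribʳ-+ H j (n ℕ.∸ j) ⟨
  (j ℕ.+ (n ℕ.∸ j)) ℕ.* H                    ≡⟨ cong (ℕ._* H) (ℕ.m+[n∸m]≡n j≤n) ⟩
  n ℕ.* H                                    ≡⟨ cong (λ d → n ℕ.* (s ℕ.+ 2 ℕ.+ d)) (ℕ.m≤n⇒m∸n≡0 2s≤j) ⟨
  n ℕ.* upperExcess s j                      ∎
  where
  open ℕ.≤-Reasoning
  2s≤j = ℕ.≮⇒≥ j≮2s
  H = s ℕ.+ 2 ℕ.+ 0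
  double : ∀ s → 2 ℕ.* s ℕ.* (s ℕ.+ 2 ℕ.+ 0) ≡ s ℕ.* s ℕ.+ 2 ℕ.* s ℕ.+ (s ℕ.* s ℕ.+ 2 ℕ.* s)
  double = ℕ-Solver.solve-∀
  n≤jH : n ℕ.≤ j ℕ.* H
  n≤jH = ℕ.≤-trans n≤s²+2s (ℕ.≤-trans (ℕ.m≤m+n _ _) (ℕ.≤-trans (ℕ.≤-reflexive (sym (double s))) (ℕ.*-monoˡ-≤ H 2s≤j)))

lowerExcess-step : ∀ {n s} j → s ℕ.* s ℕ.≤ n → n ℕ.* lowerExcess s j ℕ.≤ 2 ℕ.* n ℕ.+ (n ℕ.∸ j) ℕ.* lowerExcess s (suc j)
lowerExcess-step {n} {s} j s²≤n with j ℕ.<? s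
... | yes j<s = begin
  n ℕ.* (s ℕ.∸ j)                         ≡⟨ cong (n ℕ.*_) (m∸n≡1+[m∸1+n] j<s) ⟩
  n ℕ.* suc ℓ                             ≡⟨ ℕ.*-suc n ℓ ⟩
  n ℕ.+ n ℕ.* ℓ                           ≡⟨ cong (λ d → n ℕ.+ d ℕ.* ℓ) (ℕ.m+[n∸m]≡n j≤n) ⟨
  n ℕ.+ (j ℕ.+ (n ℕ.∸ j)) ℕ.* ℓ           ≡⟨ cong (n ℕ.+_) (ℕ.*-distribʳ-+ ℓ j (n ℕ.∸ j)) ⟩
  n ℕ.+ (j ℕ.* ℓ ℕ.+ (n ℕ.∸ j) ℕ.* ℓ)     ≤⟨ ℕ.+-monoʳ-≤ n (ℕ.+-monoˡ-≤ ((n ℕ.∸ j) ℕ.* ℓ) jℓ≤n) ⟩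
  n ℕ.+ (n ℕ.+ (n ℕ.∸ j) ℕ.* ℓ)           ≡⟨ ℕ.+-assoc n n _ ⟨
  n ℕ.+ n ℕ.+ (n ℕ.∸ j) ℕ.* ℓ             ≡⟨ cong (λ d → n ℕ.+ d ℕ.+ (n ℕ.∸ j) ℕ.* ℓ) (ℕ.+-identityʳ n) ⟨
  2 ℕ.* n ℕ.+ (n ℕ.∸ j) ℕ.* ℓ             ∎
  where
  open ℕ.≤-Reasoning
  ℓ = s ℕ.∸ suc j
  j≤n : j ℕ.≤ n
  j≤n = ℕ.≤-trans (ℕ.<⇒≤ j<s) (ℕ.≤-trans (ℕ.m≤m*n s s {{ℕ.>-nonZero (ℕ.≤-trans (s≤s z≤n) j<s)}}) s²≤n)
  jℓ≤n : j ℕ.* ℓ ℕ.≤ n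
  jℓ≤n = ℕ.≤-trans (ℕ.*-mono-≤ (ℕ.<⇒≤ j<s) (ℕ.m∸n≤m s (suc j))) s²≤n
... | no j≮s = subst (ℕ._≤ 2 ℕ.* n ℕ.+ (n ℕ.∸ j) ℕ.* lowerExcess s (suc j))
                     (sym (≡.trans (cong (n ℕ.*_) (ℕ.m≤n⇒m∸n≡0 (ℕ.≮⇒≥ j≮s))) (ℕ.*-zeroʳ n))) z≤n

m≤m*m : ∀ m → m ℕ.≤ m ℕ.* m
m≤m*m zero    = z≤n
m≤m*m (suc m) = ℕ.m≤m*n (suc m) (suc m)

floor-sqrt : ∀ n → Σ ℕ λ s → s ℕ.* s ℕ.≤ n × n ℕ.< suc s ℕ.* suc s
floor-sqrt zero = 0 , z≤n , s≤s z≤n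
floor-sqrt (suc n) with floor-sqrt n
... | s , s²≤n , n<[s+1]² with suc n ℕ.<? suc s ℕ.* suc s
...   | yes n+1<[s+1]² = s , ℕ.m≤n⇒m≤1+n s²≤n , n+1<[s+1]²
...   | no  n+1≮[s+1]² = suc s , ℕ.≤-reflexive (sym n+1≡[s+1]²) ,
                         subst (ℕ._< suc (suc s) ℕ.* suc (suc s)) (sym n+1≡[s+1]²) (ℕ.*-mono-< (ℕ.n<1+n (suc s)) (ℕ.n<1+n (suc s)))
  where
  n+1≡[s+1]² : suc n ≡ suc s ℕ.* suc s
  n+1≡[s+1]² = ℕ.≤-antisym n<[s+1]² (ℕ.≮⇒≥ n+1≮[s+1]²)

-- The lumped chain

-- AB j b: Aldous–Broder phase with j visited vertices, b recording that a new vertex was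
-- reached; Idle k: Wilson phase with a tree of k vertices; Walk k l: a Wilson walk from
-- such a tree whose loop erasure has l vertices.
data Lumped : Set where
  AB   : ℕ → Bool → Lumped
  Idle : ℕ → Lumped
  Walk : ℕ → ℕ → Lumped

lump : ∀ {n} → St n → Lumped
lump (ab visited _ newReached) = AB ∣ visited ∣ newReached
lump (wilsonIdle V)            = Idle ∣ V ∣
lump (wilsonWalk V path)       = Walk ∣ V ∣ (length path)

WellFormed : ∀ {n} → St n → Set
WellFormed (wilsonWalk V path) = Unique path × Disjoint V path
WellFormed _                   = ⊤

module LumpedChain (m : ℕ) where

  n : ℕ
  n = suc m

  N p : ℚ
  N = ℕ→ℚ n
  p = 1/ℕ n

  pN≡1 : p * N ≡ 1ℚ
  pN≡1 = ≡.trans (*-comm p N) (1/ℕ-inverseʳ m)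

  stay : ℕ → Bool → Lumped
  stay j newReached = if newReached then Idle j else AB j newReached

  loopBacks : ℕ → ℕ → List (ℚ × Lumped)
  loopBacks k zero    = []
  loopBacks k (suc l) = (p , Walk k (suc l)) ∷ loopBacks k l

  reward : Lumped → ℚ
  reward (AB j _)   = if does (j ℕ.≟ n) then 0ℚ else 1ℚ
  reward (Idle _)   = 0ℚ
  reward (Walk _ _) = 1ℚ

  forward : ℕ → Bool → List (ℚ × Lumped)
  forward j b = (p * ℕ→ℚ j , stay j b) ∷ (p * (N - ℕ→ℚ j) , AB (suc j) true) ∷ []

  moves : Lumped → List (ℚ × Lumped)
  moves (AB j b)   = if does (j ℕ.≟ n) then (1ℚ , Idle j) ∷ [] else forward j b
  moves (Idle k)   = if does (k ℕ.≟ n) then [] else (1ℚ , Walk k 1) ∷ []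
  moves (Walk k l) = (p * ℕ→ℚ k , Idle (k ℕ.+ l)) ∷ (p * (N - ℕ→ℚ k - ℕ→ℚ l) , Walk k (suc l)) ∷ loopBacks k l

  open MarkovValue reward moves public

  reward-AB-covered : ∀ {j} b → j ≡ n → reward (AB j b) ≡ 0ℚ
  reward-AB-covered {j} _ j≡n = cong (λ c → if c then 0ℚ else 1ℚ) (dec-true (j ℕ.≟ n) j≡n)

  reward-AB : ∀ {j} b → j ≢ n → reward (AB j b) ≡ 1ℚ
  reward-AB {j} _ j≢n = cong (λ c → if c then 0ℚ else 1ℚ) (dec-false (j ℕ.≟ n) j≢n)

  moves-AB-covered : ∀ {j} b → j ≡ n → moves (AB j b) ≡ (1ℚ , Idle j) ∷ []
  moves-AB-covered {j} b j≡n = cong (λ c → if c then (1ℚ , Idle j) ∷ [] else forward j b) (dec-true (j ℕ.≟ n) j≡n)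

  moves-AB : ∀ {j} b → j ≢ n → moves (AB j b) ≡ forward j b
  moves-AB {j} b j≢n = cong (λ c → if c then (1ℚ , Idle j) ∷ [] else forward j b) (dec-false (j ℕ.≟ n) j≢n)

  moves-Idle-covered : ∀ {k} → k ≡ n → moves (Idle k) ≡ []
  moves-Idle-covered {k} k≡n = cong (λ c → if c then [] else (1ℚ , Walk k 1) ∷ []) (dec-true (k ℕ.≟ n) k≡n)

  moves-Idle : ∀ {k} → k ≢ n → moves (Idle k) ≡ (1ℚ , Walk k 1) ∷ []
  moves-Idle {k} k≢n = cong (λ c → if c then [] else (1ℚ , Walk k 1) ∷ []) (dec-false (k ℕ.≟ n) k≢n)

  private
    single-move : ∀ v → 0ℚ + (1ℚ * v + 0ℚ) ≡ v
    single-move = solve-∀ ℚ-ring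

  bellman-AB-covered : ∀ f j b → j ≡ n → bellman f (AB j b) ≡ f (Idle j)
  bellman-AB-covered f j b j≡n = begin
    reward (AB j b) + expect (moves (AB j b)) f  ≡⟨ cong₂ (λ r ms → r + expect ms f) (reward-AB-covered b j≡n) (moves-AB-covered b j≡n) ⟩
    0ℚ + expect ((1ℚ , Idle j) ∷ []) f           ≡⟨ single-move (f (Idle j)) ⟩
    f (Idle j)                                   ∎
    where open ≡-Reasoning

  bellman-AB : ∀ f j b → j ≢ n →
               bellman f (AB j b) ≡ 1ℚ + p * (ℕ→ℚ j * f (stay j b) + (N - ℕ→ℚ j) * f (AB (suc j) true))
  bellman-AB f j b j≢n = begin
    reward (AB j b) + expect (moves (AB j b)) f  ≡⟨ cong₂ (λ r ms → r + expect ms f) (reward-AB b j≢n) (moves-AB b j≢n) ⟩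
    1ℚ + expect (forward j b) f                  ≡⟨ two-moves p (ℕ→ℚ j) N (f (stay j b)) (f (AB (suc j) true)) ⟩
    1ℚ + p * (ℕ→ℚ j * f (stay j b) + (N - ℕ→ℚ j) * f (AB (suc j) true)) ∎
    where
    open ≡-Reasoning
    two-moves : ∀ p j N a b → 1ℚ + (p * j * a + (p * (N - j) * b + 0ℚ)) ≡ 1ℚ + p * (j * a + (N - j) * b)
    two-moves = solve-∀ ℚ-ring

  bellman-Idle-covered : ∀ f k → k ≡ n → bellman f (Idle k) ≡ 0ℚ
  bellman-Idle-covered f k k≡n = ≡.trans (cong (λ ms → 0ℚ + expect ms f) (moves-Idle-covered k≡n)) (+-identityʳ 0ℚ)

  bellman-Idle : ∀ f k → k ≢ n → bellman f (Idle k) ≡ f (Walk k 1)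
  bellman-Idle f k k≢n = ≡.trans (cong (λ ms → 0ℚ + expect ms f) (moves-Idle k≢n)) (single-move (f (Walk k 1)))

  expect-loopBacks : ∀ f k l → expect (loopBacks k l) f ≡ p * sumTo (f ∘ Walk k) l
  expect-loopBacks f k zero    = sym (*-zeroʳ p)
  expect-loopBacks f k (suc l) = ≡.trans (cong (p * f (Walk k (suc l)) +_) (expect-loopBacks f k l))
                                         (distrib p (f (Walk k (suc l))) (sumTo (f ∘ Walk k) l))
    where
    distrib : ∀ p a s → p * a + p * s ≡ p * (s + a)
    distrib = solve-∀ ℚ-ring

  bellman-Walk : ∀ f k l → bellman f (Walk k l) ≡
                 1ℚ + p * (ℕ→ℚ k * f (Idle (k ℕ.+ l)) + sumTo (f ∘ Walk k) l + (N - ℕ→ℚ k - ℕ→ℚ l) * f (Walk k (suc l)))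
  bellman-Walk f k l = ≡.trans (cong (λ e → 1ℚ + (p * ℕ→ℚ k * a + (p * c * b + e))) (expect-loopBacks f k l))
                               (factor-p p (ℕ→ℚ k) a c b (sumTo (f ∘ Walk k) l))
    where
    a = f (Idle (k ℕ.+ l))
    b = f (Walk k (suc l))
    c = N - ℕ→ℚ k - ℕ→ℚ l
    factor-p : ∀ p k a c b s → 1ℚ + (p * k * a + (p * c * b + p * s)) ≡ 1ℚ + p * (k * a + s + c * b)
    factor-p = solve-∀ ℚ-ring

  nodeValue : ℕ → Node n → ℚ
  nodeValue T done          = 0ℚ
  nodeValue T (walk next)   = 1ℚ + p * sumFin n (λ x → Etrunc m T (next x))
  nodeValue T (pick s₀ ss)  = 1/ℕ (suc (length ss)) * sumℚ (map (Etrunc m T) (s₀ ∷ ss))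

  Etrunc-unfold : ∀ T s → Etrunc m (suc T) s ≡ nodeValue T (trans s)
  Etrunc-unfold T s with trans s
  ... | done       = refl
  ... | walk _     = refl
  ... | pick _ _   = refl

  sumℚ-map-const : ∀ {A : Set} (φ : A → ℚ) c xs → All (λ x → φ x ≡ c) xs → sumℚ (map φ xs) ≡ ℕ→ℚ (length xs) * c
  sumℚ-map-const φ c []       []             = sym (*-zeroˡ c)
  sumℚ-map-const φ c (x ∷ xs) (φx≡c ∷ φxs≡c) = begin
    φ x + sumℚ (map φ xs)          ≡⟨ cong₂ _+_ φx≡c (sumℚ-map-const φ c xs φxs≡c) ⟩
    c + ℕ→ℚ (length xs) * c        ≡⟨ one-more (ℕ→ℚ (length xs)) c ⟩
    (1ℚ + ℕ→ℚ (length xs)) * c     ≡⟨ cong (_* c) (ℕ→ℚ-suc (length xs)) ⟨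
    ℕ→ℚ (suc (length xs)) * c      ∎
    where
    open ≡-Reasoning
    one-more : ∀ l c → c + l * c ≡ (1ℚ + l) * c
    one-more = solve-∀ ℚ-ring

  lumping : ∀ T s → WellFormed s → Etrunc m T s ≡ value T (lump s)
  lumping zero    s _ = refl
  lumping (suc T) (ab visited current new) _ = ≡.trans (Etrunc-unfold T (ab visited current new)) (ab-step (covered visited))
    where
    j = ∣ visited ∣
    next : Fin n → St n
    next x = if lookup visited x then (if new then wilsonIdle visited else ab visited x new) else ab (visited ∪ ⁅ x ⁆) x true
    next-lumped : ∀ x → Etrunc m T (next x) ≡ (if lookup visited x then value T (stay j new) else value T (AB (suc j) true))
    next-lumped x with lookup visited x in x∈?
    ... | true  = stay-lumped new
      where
      stay-lumped : ∀ b → Etrunc m T (if b then wilsonIdle visited else ab visited x b) ≡ value T (stay j b)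
      stay-lumped true  = lumping T (wilsonIdle visited) tt
      stay-lumped false = lumping T (ab visited x false) tt
    ... | false = ≡.trans (lumping T (ab (visited ∪ ⁅ x ⁆) x true) tt) (cong (λ i → value T (AB i true)) (∣W∪⁅x⁆∣ visited x x∈?))
    ab-step : ∀ c → nodeValue T (if c then pick (wilsonIdle visited) [] else walk next)
                    ≡ (if c then 0ℚ else 1ℚ)
                      + expect (if c then (1ℚ , Idle j) ∷ []
                                else forward j new) (value T)
    ab-step true  = ≡.trans (cong (λ e → 1ℚ * (e + 0ℚ)) (lumping T (wilsonIdle visited) tt)) (covered-step (value T (Idle j)))
      where
      covered-step : ∀ v → 1ℚ * (v + 0ℚ) ≡ 0ℚ + (1ℚ * v + 0ℚ)
      covered-step = solve-∀ ℚ-ring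
    ab-step false = ≡.trans (cong (λ s → 1ℚ + p * s) (≡.trans (sumFin-cong n next-lumped) (sumFin-indicator visited _ _)))
                            (sym (spread p (ℕ→ℚ j) N (value T (stay j new)) (value T (AB (suc j) true))))
      where
      spread : ∀ p j N a b → 1ℚ + (p * j * a + (p * (N - j) * b + 0ℚ)) ≡ 1ℚ + p * (j * a + (N - j) * b)
      spread = solve-∀ ℚ-ring
  lumping (suc T) (wilsonIdle V) _ = ≡.trans (Etrunc-unfold T (wilsonIdle V)) idle-step
    where
    idle-step : nodeValue T (trans (wilsonIdle V)) ≡ value (suc T) (Idle ∣ V ∣)
    idle-step with filterᵇ (λ x → not (lookup V x)) (allFin n) in unvisited
    ... | [] = sym (bellman-Idle-covered (value T) ∣ V ∣ (full⇒∣V∣≡n V λ x → not-injective (filterᵇ≡[] (λ x → not (lookup V x)) id unvisited x)))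
    ... | v ∷ vs = begin
      1/ℕ (suc (length (map start vs))) * sumℚ (map (Etrunc m T) (start v ∷ map start vs))
        ≡⟨ cong (1/ℕ (suc (length (map start vs))) *_) (sumℚ-map-const (Etrunc m T) (value T (Walk ∣ V ∣ 1)) _ (starts-lumped (v ∷ vs) all-unvisited)) ⟩
      1/ℕ (suc (length (map start vs))) * (ℕ→ℚ (suc (length (map start vs))) * value T (Walk ∣ V ∣ 1))
        ≡⟨ *-cancel-inverse {1/ℕ (suc (length (map start vs)))} {ℕ→ℚ (suc (length (map start vs)))}
                            (value T (Walk ∣ V ∣ 1)) (1/ℕ-inverseʳ (length (map start vs))) ⟩
      value T (Walk ∣ V ∣ 1)
        ≡⟨ bellman-Idle (value T) ∣ V ∣ (λ ∣V∣≡n → not-¬ (∣V∣≡n⇒full V v ∣V∣≡n) (Equivalence.to T-not-≡ (All.head all-unvisited))) ⟨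
      value (suc T) (Idle ∣ V ∣) ∎
      where
      open ≡-Reasoning
      start : Fin n → St n
      start w = wilsonWalk V (w ∷ [])
      all-unvisited : All (True ∘ λ x → not (lookup V x)) (v ∷ vs)
      all-unvisited = subst (All (True ∘ λ x → not (lookup V x))) unvisited (all-filter (T? ∘ λ x → not (lookup V x)) (allFin n))
      starts-lumped : ∀ ws → All (True ∘ λ x → not (lookup V x)) ws → All (λ s → Etrunc m T s ≡ value T (Walk ∣ V ∣ 1)) (map start ws)
      starts-lumped []       []                = []
      starts-lumped (w ∷ ws) (w∉V ∷ ws∉V) = lumping T (start w) (([] ∷ []) , (Equivalence.to T-not-≡ w∉V ∷ [])) ∷ starts-lumped ws ws∉V
  lumping (suc T) (wilsonWalk V path) (unique , disjoint) = begin
    Etrunc m (suc T) (wilsonWalk V path)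
      ≡⟨ Etrunc-unfold T (wilsonWalk V path) ⟩
    1ℚ + p * sumFin n (λ x → Etrunc m T (if lookup V x then wilsonIdle (addAll V path) else wilsonWalk V (erase x path)))
      ≡⟨ cong (λ s → 1ℚ + p * s) (≡.trans (sumFin-cong n next-lumped) (sumFin-nextValue n V a b h path unique disjoint)) ⟩
    1ℚ + p * (ℕ→ℚ k * a + (N - ℕ→ℚ k - ℕ→ℚ l) * b + sumTo h l)
      ≡⟨ cong (λ s → 1ℚ + p * s) (swap (ℕ→ℚ k * a) ((N - ℕ→ℚ k - ℕ→ℚ l) * b) (sumTo h l)) ⟩
    1ℚ + p * (ℕ→ℚ k * a + sumTo h l + (N - ℕ→ℚ k - ℕ→ℚ l) * b)
      ≡⟨ bellman-Walk (value T) k l ⟨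
    value (suc T) (Walk k l) ∎
    where
    open ≡-Reasoning
    k = ∣ V ∣
    l = length path
    a = value T (Idle (k ℕ.+ l))
    b = value T (Walk k (suc l))
    h = value T ∘ Walk k
    swap : ∀ x y z → x + y + z ≡ x + z + y
    swap = solve-∀ ℚ-ring
    next-lumped : ∀ x → Etrunc m T (if lookup V x then wilsonIdle (addAll V path) else wilsonWalk V (erase x path))
                        ≡ nextValue V path a b h x
    next-lumped x with lookup V x in x∈?
    ... | true = ≡.trans (lumping T (wilsonIdle (addAll V path)) tt) (cong (value T ∘ Idle) (∣addAll∣ V path unique disjoint))
    ... | false with dropTo x path in dropped
    ...   | nothing = lumping T (wilsonWalk V (x ∷ path)) ((dropTo-nothing⇒∉ x path dropped ∷ unique) , (x∈? ∷ disjoint))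
    ...   | just q  = lumping T (wilsonWalk V q) ( dropTo-preserves AllPairs.tail x path dropped unique
                                                 , dropTo-preserves All.tail x path dropped disjoint)

  Valid : Lumped → Set
  Valid (AB j true)  = 1 ℕ.≤ j × j ℕ.≤ n
  Valid (AB j false) = j ≡ 1
  Valid (Idle k)     = 1 ℕ.≤ k × k ℕ.≤ n
  Valid (Walk k l)   = 1 ℕ.≤ k × 1 ℕ.≤ l × k ℕ.+ l ℕ.≤ n

  Valid-AB⇒≤n : ∀ {j} b → Valid (AB j b) → j ℕ.≤ n
  Valid-AB⇒≤n true  (_ , j≤n) = j≤n
  Valid-AB⇒≤n false refl      = s≤s z≤n

  Valid-stay : ∀ {j} b → Valid (AB j b) → Valid (stay j b)
  Valid-stay true  valid = valid
  Valid-stay false valid = valid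

  Valid-next : ∀ {j} b → Valid (AB j b) → j ≢ n → Valid (AB (suc j) true)
  Valid-next true  (_ , j≤n) j≢n = s≤s z≤n , ℕ.≤∧≢⇒< j≤n j≢n
  Valid-next false refl      1≢n = s≤s z≤n , s≤s (ℕ.n≢0⇒n>0 (1≢n ∘ cong suc ∘ sym))

  N-nonNeg : ∀ {j} → j ℕ.≤ n → 0ℚ ≤ N - ℕ→ℚ j
  N-nonNeg j≤n = p≤q⇒0≤q-p (ℕ→ℚ-mono-≤ j≤n)

  N-minus-+ : ∀ k l → N - ℕ→ℚ k - ℕ→ℚ l ≡ N - ℕ→ℚ (k ℕ.+ l)
  N-minus-+ k l = ≡.trans (minus-sum N (ℕ→ℚ k) (ℕ→ℚ l)) (cong (λ x → N - x) (sym (ℕ→ℚ-homo-+ k l)))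
    where
    minus-sum : ∀ N a b → N - a - b ≡ N - (a + b)
    minus-sum = solve-∀ ℚ-ring

  N-minus-nonNeg : ∀ {k l} → k ℕ.+ l ℕ.≤ n → 0ℚ ≤ N - ℕ→ℚ k - ℕ→ℚ l
  N-minus-nonNeg {k} {l} k+l≤n = subst (0ℚ ≤_) (sym (N-minus-+ k l)) (N-nonNeg k+l≤n)

  N-minus-full : ∀ {k l} → k ℕ.+ l ≡ n → N - ℕ→ℚ k - ℕ→ℚ l ≡ 0ℚ
  N-minus-full {k} {l} k+l≡n = ≡.trans (N-minus-+ k l) (≡.trans (cong (λ i → N - ℕ→ℚ i) k+l≡n) (+-inverseʳ N))

  p-nonNeg : 0ℚ ≤ p
  p-nonNeg = 1/ℕ-nonNeg n

  p*-nonNeg : ∀ {x} → 0ℚ ≤ x → 0ℚ ≤ p * x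
  p*-nonNeg = *-nonNeg p-nonNeg

  loopBacks-admissible : ∀ {k} l → 1 ℕ.≤ k → k ℕ.+ l ℕ.≤ n → All (Admissible Valid) (loopBacks k l)
  loopBacks-admissible zero    _   _     = []
  loopBacks-admissible {k} (suc l) 1≤k k+l<n =
    (p-nonNeg , inj₂ (1≤k , s≤s z≤n , k+l<n)) ∷ loopBacks-admissible l 1≤k (ℕ.≤-trans (ℕ.+-monoʳ-≤ k (ℕ.n≤1+n l)) k+l<n)

  moves-admissible : ∀ x → Valid x → All (Admissible Valid) (moves x)
  moves-admissible (AB j b) valid = by-cover (j ℕ.≟ n)
    where
    one≤j : ∀ b → Valid (AB j b) → 1 ℕ.≤ j
    one≤j true  (1≤j , _) = 1≤j
    one≤j false refl      = s≤s z≤n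
    by-cover : Dec (j ≡ n) → All (Admissible Valid) (moves (AB j b))
    by-cover (yes j≡n) = subst (All (Admissible Valid)) (sym (moves-AB-covered b j≡n))
                               ((ℕ→ℚ-nonNeg 1 , inj₂ (one≤j b valid , Valid-AB⇒≤n b valid)) ∷ [])
    by-cover (no j≢n)  = subst (All (Admissible Valid)) (sym (moves-AB b j≢n))
                               ( (p*-nonNeg (ℕ→ℚ-nonNeg j) , inj₂ (Valid-stay b valid))
                               ∷ (p*-nonNeg (N-nonNeg (Valid-AB⇒≤n b valid)) , inj₂ (Valid-next b valid j≢n)) ∷ [])
  moves-admissible (Idle k) (1≤k , k≤n) = by-cover (k ℕ.≟ n)
    where
    by-cover : Dec (k ≡ n) → All (Admissible Valid) (moves (Idle k))
    by-cover (yes k≡n) = subst (All (Admissible Valid)) (sym (moves-Idle-covered k≡n)) []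
    by-cover (no k≢n)  = subst (All (Admissible Valid)) (sym (moves-Idle k≢n))
                               ((ℕ→ℚ-nonNeg 1 , inj₂ (1≤k , s≤s z≤n , subst (ℕ._≤ n) (ℕ.+-comm 1 k) (ℕ.≤∧≢⇒< k≤n k≢n))) ∷ [])
  moves-admissible (Walk k l) (1≤k , 1≤l , k+l≤n) =
    (p*-nonNeg (ℕ→ℚ-nonNeg k) , inj₂ (ℕ.≤-trans 1≤k (ℕ.m≤m+n k l) , k+l≤n))
    ∷ (p*-nonNeg (N-minus-nonNeg {k} {l} k+l≤n) , extend)
    ∷ loopBacks-admissible l 1≤k k+l≤n
    where
    extend : p * (N - ℕ→ℚ k - ℕ→ℚ l) ≡ 0ℚ ⊎ Valid (Walk k (suc l))
    extend with k ℕ.+ l ℕ.≟ n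
    ... | yes k+l≡n = inj₁ (≡.trans (cong (p *_) (N-minus-full {k} {l} k+l≡n)) (*-zeroʳ p))
    ... | no k+l≢n  = inj₂ (1≤k , s≤s z≤n , subst (ℕ._≤ n) (sym (ℕ.+-suc k l)) (ℕ.≤∧≢⇒< {k ℕ.+ l} k+l≤n k+l≢n))

  open Comparison Valid moves-admissible public

  -- Expected number of remaining steps of Wilson's algorithm from a tree with k vertices,
  -- and from a walk whose loop erasure has l vertices.
  idleCost : ℕ → ℚ
  idleCost k = (N - ℕ→ℚ k) * (ℕ→ℚ k + 1ℚ) * 1/ℕ k

  walkDiscount : ℕ → ℕ → ℚ
  walkDiscount k zero    = 0ℚ
  walkDiscount k (suc l) = walkDiscount k l + ℕ→ℚ k * 1/ℕ (k ℕ.+ l)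

  walkCost : ℕ → ℕ → ℚ
  walkCost k l = idleCost k + 1ℚ - walkDiscount k l

  walkGain : ℕ → ℕ → ℚ
  walkGain k l = ℕ→ℚ k * idleCost (k ℕ.+ l) + sumTo (walkCost k) l + (N - ℕ→ℚ k - ℕ→ℚ l) * walkCost k (suc l)

  idleCost-covered : idleCost n ≡ 0ℚ
  idleCost-covered = vanish N p
    where
    vanish : ∀ N i → (N - N) * (N + 1ℚ) * i ≡ 0ℚ
    vanish = solve-∀ ℚ-ring

  *-idleCost : ∀ k → ℕ→ℚ (suc k) * idleCost (suc k) ≡ (N - ℕ→ℚ (suc k)) * (ℕ→ℚ (suc k) + 1ℚ)
  *-idleCost k = ≡-modulo-unit ((N - K) * (K + 1ℚ)) (1/ℕ-inverseʳ k) (expand K N (1/ℕ (suc k)))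
    where
    K = ℕ→ℚ (suc k)
    expand : ∀ K N i → K * ((N - K) * (K + 1ℚ) * i) ≡ (N - K) * (K + 1ℚ) + (N - K) * (K + 1ℚ) * (K * i - 1ℚ)
    expand = solve-∀ ℚ-ring

  walkCost-1 : ∀ k → walkCost (suc k) 1 ≡ idleCost (suc k)
  walkCost-1 k = begin
    W + 1ℚ - (0ℚ + K * 1/ℕ (suc k ℕ.+ 0))  ≡⟨ cong (λ i → W + 1ℚ - (0ℚ + K * 1/ℕ i)) (ℕ.+-identityʳ (suc k)) ⟩
    W + 1ℚ - (0ℚ + K * 1/ℕ (suc k))         ≡⟨ ≡-modulo-unit (- 1ℚ) (1/ℕ-inverseʳ k) (expand W K (1/ℕ (suc k))) ⟩
    W                                        ∎
    where
    open ≡-Reasoning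
    W = idleCost (suc k)
    K = ℕ→ℚ (suc k)
    expand : ∀ W K i → W + 1ℚ - (0ℚ + K * i) ≡ W + (- 1ℚ) * (K * i - 1ℚ)
    expand = solve-∀ ℚ-ring

  walkGain-0 : ∀ k → walkGain (suc k) 0 ≡ N * (idleCost (suc k) - walkDiscount (suc k) 0)
  walkGain-0 k = ≡.trans (cong₂ (λ a w → ℕ→ℚ (suc k) * idleCost a + 0ℚ + (N - ℕ→ℚ (suc k) - 0ℚ) * w) (ℕ.+-identityʳ (suc k)) (walkCost-1 k))
                        (collect (ℕ→ℚ (suc k)) N (idleCost (suc k)))
    where
    collect : ∀ K N W → K * W + 0ℚ + (N - K - 0ℚ) * W ≡ N * (W - 0ℚ)
    collect = solve-∀ ℚ-ring

  walkGain-step : ∀ k l → walkGain (suc k) (suc l) ≡ walkGain (suc k) l - N * ℕ→ℚ (suc k) * 1/ℕ (suc k ℕ.+ l)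
  walkGain-step k l = begin
    walkGain (suc k) (suc l)
      ≡⟨ cong₂ (λ A′ L′ → K * ((N - A′) * (A′ + 1ℚ) * i′) + (S + F₁) + (N - K - L′) * F₂) (ℕ→ℚ-homo-+ (suc k) (suc l)) (ℕ→ℚ-suc l)
         ⟩
    K * ((N - (K + ℕ→ℚ (suc l))) * (K + ℕ→ℚ (suc l) + 1ℚ) * i′) + (S + F₁) + (N - K - (1ℚ + L)) * F₂
      ≡⟨ cong (λ L′ → K * ((N - (K + L′)) * (K + L′ + 1ℚ) * i′) + (S + F₁) + (N - K - (1ℚ + L)) * F₂) (ℕ→ℚ-suc l) ⟩
    K * ((N - (K + (1ℚ + L))) * (K + (1ℚ + L) + 1ℚ) * i′) + (S + F₁) + (N - K - (1ℚ + L)) * F₂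
      ≡⟨ ≡-modulo-unit (K * (N - (K + L) - 1ℚ)) unit′
           (≡-modulo-unit (- (K * (N - (K + L) - 1ℚ))) unit (expand K L N W D₁ i i′ S)) ⟩
    K * ((N - (K + L)) * (K + L + 1ℚ) * i) + S + (N - K - L) * F₁ - N * K * i
      ≡⟨ cong (λ A → K * ((N - A) * (A + 1ℚ) * i) + S + (N - K - L) * F₁ - N * K * i) (ℕ→ℚ-homo-+ (suc k) l) ⟨
    walkGain (suc k) l - N * K * i ∎
    where
    open ≡-Reasoning
    K = ℕ→ℚ (suc k)
    L = ℕ→ℚ l
    W = idleCost (suc k)
    D₁ = walkDiscount (suc k) (suc l)
    S = sumTo (walkCost (suc k)) l
    F₁ = walkCost (suc k) (suc l)
    F₂ = walkCost (suc k) (suc (suc l))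
    i = 1/ℕ (suc k ℕ.+ l)
    i′ = 1/ℕ (suc k ℕ.+ suc l)
    unit : (K + L) * i ≡ 1ℚ
    unit = ≡.trans (cong (_* i) (sym (ℕ→ℚ-homo-+ (suc k) l))) (1/ℕ-inverseʳ (k ℕ.+ l))
    unit′ : (K + (1ℚ + L)) * i′ ≡ 1ℚ
    unit′ = ≡.trans (cong (_* i′) (sym (≡.trans (ℕ→ℚ-homo-+ (suc k) (suc l)) (cong (K +_) (ℕ→ℚ-suc l)))))
                    (1/ℕ-inverseʳ (k ℕ.+ suc l))
    expand : ∀ K L N W D i i′ S →
      K * ((N - (K + (1ℚ + L))) * (K + (1ℚ + L) + 1ℚ) * i′) + (S + (W + 1ℚ - D)) + (N - K - (1ℚ + L)) * (W + 1ℚ - (D + K * i′))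
      ≡ K * ((N - (K + L)) * (K + L + 1ℚ) * i) + S + (N - K - L) * (W + 1ℚ - D) - N * K * i
        + K * (N - (K + L) - 1ℚ) * ((K + (1ℚ + L)) * i′ - 1ℚ) + (- (K * (N - (K + L) - 1ℚ))) * ((K + L) * i - 1ℚ)
    expand = solve-∀ ℚ-ring

  walkGain-closed : ∀ k l → walkGain (suc k) l ≡ N * (idleCost (suc k) - walkDiscount (suc k) l)
  walkGain-closed k zero    = walkGain-0 k
  walkGain-closed k (suc l) = begin
    walkGain (suc k) (suc l)                        ≡⟨ walkGain-step k l ⟩
    walkGain (suc k) l - N * K * i                  ≡⟨ cong (_- N * K * i) (walkGain-closed k l) ⟩
    N * (W - walkDiscount (suc k) l) - N * K * i    ≡⟨ distrib N W (walkDiscount (suc k) l) K i ⟩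
    N * (W - walkDiscount (suc k) (suc l))          ∎
    where
    open ≡-Reasoning
    K = ℕ→ℚ (suc k)
    W = idleCost (suc k)
    i = 1/ℕ (suc k ℕ.+ l)
    distrib : ∀ N W D K i → N * (W - D) - N * K * i ≡ N * (W - (D + K * i))
    distrib = solve-∀ ℚ-ring

  walkCost-bellman : ∀ k l → 1ℚ + p * walkGain (suc k) l ≡ walkCost (suc k) l
  walkCost-bellman k l = begin
    1ℚ + p * walkGain (suc k) l          ≡⟨ cong (λ g → 1ℚ + p * g) (walkGain-closed k l) ⟩
    1ℚ + p * (N * (W - D))               ≡⟨ cong (1ℚ +_) (*-cancel-inverse {p} {N} (W - D) (1/ℕ-inverseʳ m)) ⟩
    1ℚ + (W - D)                         ≡⟨ reorder W D ⟩
    W + 1ℚ - D                           ∎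
    where
    open ≡-Reasoning
    reorder : ∀ W D → 1ℚ + (W - D) ≡ W + 1ℚ - D
    reorder = solve-∀ ℚ-ring
    W = idleCost (suc k)
    D = walkDiscount (suc k) l

  idleCost-nonNeg : ∀ {k} → k ℕ.≤ n → 0ℚ ≤ idleCost k
  idleCost-nonNeg {k} k≤n = *-nonNeg (*-nonNeg (N-nonNeg k≤n) (+-mono-≤ (ℕ→ℚ-nonNeg k) (ℕ→ℚ-nonNeg 1))) (1/ℕ-nonNeg k)

  idleCost-split : ∀ k → idleCost (suc k) ≡ N - ℕ→ℚ (suc k) + (N - ℕ→ℚ (suc k)) * 1/ℕ (suc k)
  idleCost-split k = ≡-modulo-unit (N - ℕ→ℚ (suc k)) (1/ℕ-inverseʳ k) (expand N (ℕ→ℚ (suc k)) (1/ℕ (suc k)))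
    where
    expand : ∀ N K i → (N - K) * (K + 1ℚ) * i ≡ N - K + (N - K) * i + (N - K) * (K * i - 1ℚ)
    expand = solve-∀ ℚ-ring

  N-≤-idleCost : ∀ {k} → suc k ℕ.≤ n → N - ℕ→ℚ (suc k) ≤ idleCost (suc k)
  N-≤-idleCost {k} k<n = ≤-by-slack ((N - ℕ→ℚ (suc k)) * 1/ℕ (suc k)) (idleCost-split k) (*-nonNeg (N-nonNeg k<n) (1/ℕ-nonNeg (suc k)))

  idleCost-≤ : ∀ {k} → suc k ℕ.≤ n → idleCost (suc k) ≤ N + N
  idleCost-≤ {k} k<n = begin
    idleCost (suc k)                              ≡⟨ idleCost-split k ⟩
    N - K + (N - K) * 1/ℕ (suc k)                 ≤⟨ +-monoʳ-≤ (N - K) (*-monoˡ-≤-nonNeg′ (N-nonNeg k<n) (1/ℕ-≤-1 (suc k))) ⟩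
    N - K + (N - K) * 1ℚ                          ≡⟨ cong (N - K +_) (*-identityʳ (N - K)) ⟩
    N - K + (N - K)                               ≤⟨ +-mono-≤ (p-q≤p N (ℕ→ℚ-nonNeg (suc k))) (p-q≤p N (ℕ→ℚ-nonNeg (suc k))) ⟩
    N + N                                         ∎
    where
    open ≤-Reasoning
    K = ℕ→ℚ (suc k)

  walkDiscount-nonNeg : ∀ k l → 0ℚ ≤ walkDiscount k l
  walkDiscount-nonNeg k zero    = ≤-refl
  walkDiscount-nonNeg k (suc l) = +-mono-≤ (walkDiscount-nonNeg k l) (*-nonNeg (ℕ→ℚ-nonNeg k) (1/ℕ-nonNeg (k ℕ.+ l)))

  walkDiscount-≤ : ∀ k l → walkDiscount (suc k) l ≤ ℕ→ℚ l
  walkDiscount-≤ k zero    = ≤-refl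
  walkDiscount-≤ k (suc l) = begin
    walkDiscount (suc k) l + ℕ→ℚ (suc k) * 1/ℕ (suc k ℕ.+ l)  ≤⟨ +-mono-≤ (walkDiscount-≤ k l) term≤1 ⟩
    ℕ→ℚ l + 1ℚ                                               ≡⟨ +-comm (ℕ→ℚ l) 1ℚ ⟩
    1ℚ + ℕ→ℚ l                                               ≡⟨ ℕ→ℚ-suc l ⟨
    ℕ→ℚ (suc l)                                              ∎
    where
    open ≤-Reasoning
    term≤1 : ℕ→ℚ (suc k) * 1/ℕ (suc k ℕ.+ l) ≤ 1ℚ
    term≤1 = ≤-trans (*-monoʳ-≤-nonNeg (1/ℕ (suc k ℕ.+ l)) {{nonNegative (1/ℕ-nonNeg (suc k ℕ.+ l))}} (ℕ→ℚ-mono-≤ (ℕ.m≤m+n (suc k) l)))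
                     (≤-reflexive (1/ℕ-inverseʳ (k ℕ.+ l)))

  walkCost-nonNeg : ∀ {k l} → 1 ℕ.≤ k → k ℕ.+ l ℕ.≤ n → 0ℚ ≤ walkCost k l
  walkCost-nonNeg {suc k} {l} _ k+l≤n = p≤q⇒0≤q-p (begin
    walkDiscount (suc k) l       ≤⟨ walkDiscount-≤ k l ⟩
    L                            ≤⟨ ≤-by-slack (N - K - L) (regroup N K L) (N-minus-nonNeg {suc k} {l} k+l≤n) ⟩
    N - K                        ≤⟨ N-≤-idleCost (ℕ.≤-trans (ℕ.m≤m+n (suc k) l) k+l≤n) ⟩
    idleCost (suc k)             ≤⟨ ≤-by-slack 1ℚ refl (ℕ→ℚ-nonNeg 1) ⟩
    idleCost (suc k) + 1ℚ        ∎)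
    where
    open ≤-Reasoning
    K = ℕ→ℚ (suc k)
    L = ℕ→ℚ l
    regroup : ∀ N K L → N - K ≡ L + (N - K - L)
    regroup = solve-∀ ℚ-ring

  walkCost-≤ : ∀ {k l} → suc k ℕ.≤ n → walkCost (suc k) l ≤ N + (N + 1ℚ)
  walkCost-≤ {k} {l} k<n = begin
    idleCost (suc k) + 1ℚ - walkDiscount (suc k) l  ≤⟨ p-q≤p (idleCost (suc k) + 1ℚ) (walkDiscount-nonNeg (suc k) l) ⟩
    idleCost (suc k) + 1ℚ                           ≤⟨ +-monoˡ-≤ 1ℚ (idleCost-≤ k<n) ⟩
    N + N + 1ℚ                                      ≡⟨ +-assoc N N 1ℚ ⟩
    N + (N + 1ℚ)                                    ∎
    where open ≤-Reasoning

  p*-≤ : ∀ {x y} → x ≤ N * y → p * x ≤ y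
  p*-≤ {x} {y} x≤Ny = ≤-trans (*-monoˡ-≤-nonNeg′ p-nonNeg x≤Ny) (≤-reflexive (*-cancel-inverse {p} {N} y (1/ℕ-inverseʳ m)))

  ≤-p* : ∀ {x y} → N * y ≤ x → y ≤ p * x
  ≤-p* {x} {y} Ny≤x = ≤-trans (≤-reflexive (sym (*-cancel-inverse {p} {N} y (1/ℕ-inverseʳ m)))) (*-monoˡ-≤-nonNeg′ p-nonNeg Ny≤x)

  1≢n : 1 ℕ.≤ m → 1 ≢ n
  1≢n 1≤m 1≡n = ℕ.<⇒≢ 1≤m (ℕ.suc-injective 1≡n)

  -- Since k · idleCost k = (N - k)(k + 1), the Bellman condition at AB j true reduces to a
  -- condition on the excess: N + (N - j) e (j + 1) ≤ N e j.
  potential : (ℕ → ℚ) → ℚ → Lumped → ℚ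
  potential excess bonus (AB j true)  = N - ℕ→ℚ j + excess j
  potential excess bonus (AB _ false) = N - ℕ→ℚ 2 + excess 2 + bonus
  potential excess bonus (Idle k)     = idleCost k
  potential excess bonus (Walk k l)   = walkCost k l

  module _ (e : ℕ → ℚ) (c : ℚ) where

    potential-bellman-Idle : ∀ k → Valid (Idle k) → bellman (potential e c) (Idle k) ≡ idleCost k
    potential-bellman-Idle (suc k) _ = by-cover (suc k ℕ.≟ n)
      where
      by-cover : Dec (suc k ≡ n) → bellman (potential e c) (Idle (suc k)) ≡ idleCost (suc k)
      by-cover (yes k+1≡n) = ≡.trans (bellman-Idle-covered (potential e c) (suc k) k+1≡n)
                                     (≡.trans (sym idleCost-covered) (cong idleCost (sym k+1≡n)))
      by-cover (no k+1≢n)  = ≡.trans (bellman-Idle (potential e c) (suc k) k+1≢n) (walkCost-1 k)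

    potential-bellman-Walk : ∀ k l → Valid (Walk k l) → bellman (potential e c) (Walk k l) ≡ walkCost k l
    potential-bellman-Walk (suc k) l _ = ≡.trans (bellman-Walk (potential e c) (suc k) l) (walkCost-bellman k l)

    potential-bellman-covered : ∀ j b → j ≡ n → bellman (potential e c) (AB j b) ≡ 0ℚ
    potential-bellman-covered j b refl = ≡.trans (bellman-AB-covered (potential e c) n b refl) idleCost-covered

    potential-bellman-AB : ∀ j → 1 ℕ.≤ j → j ≢ n →
                           bellman (potential e c) (AB j true) ≡ N - ℕ→ℚ j + p * (N + (N - ℕ→ℚ j) * e (suc j))
    potential-bellman-AB (suc j) _ j+1≢n = begin
      bellman (potential e c) (AB (suc j) true)
        ≡⟨ bellman-AB (potential e c) (suc j) true j+1≢n ⟩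
      1ℚ + p * (J * idleCost (suc j) + (N - J) * (N - ℕ→ℚ (suc (suc j)) + e (suc (suc j))))
        ≡⟨ cong₂ (λ w J′ → 1ℚ + p * (w + (N - J) * (N - J′ + e (suc (suc j))))) (*-idleCost j) (ℕ→ℚ-suc (suc j)) ⟩
      1ℚ + p * ((N - J) * (J + 1ℚ) + (N - J) * (N - (1ℚ + J) + e (suc (suc j))))
        ≡⟨ ≡-modulo-unit (N - J - 1ℚ) pN≡1 (expand N J p (e (suc (suc j)))) ⟩
      N - J + p * (N + (N - J) * e (suc (suc j))) ∎
      where
      open ≡-Reasoning
      J = ℕ→ℚ (suc j)
      expand : ∀ N J p E → 1ℚ + p * ((N - J) * (J + 1ℚ) + (N - J) * (N - (1ℚ + J) + E))
                           ≡ N - J + p * (N + (N - J) * E) + (N - J - 1ℚ) * (p * N - 1ℚ)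
      expand = solve-∀ ℚ-ring

    potential-bellman-start : 1 ≢ n → bellman (potential e c) (AB 1 false) ≡ N - ℕ→ℚ 2 + e 2 + (1ℚ + p * c)
    potential-bellman-start 1≢n =
      ≡.trans (bellman-AB (potential e c) 1 false 1≢n) (≡-modulo-unit (N - ℕ→ℚ 2 + e 2) pN≡1 (expand N (ℕ→ℚ 2) (e 2) p c))
      where
      expand : ∀ N t E p c → 1ℚ + p * (1ℚ * (N - t + E + c) + (N - 1ℚ) * (N - t + E))
                             ≡ N - t + E + (1ℚ + p * c) + (N - t + E) * (p * N - 1ℚ)
      expand = solve-∀ ℚ-ring

    potential-supersolution : 1 ℕ.≤ m → (∀ j → 1 ℕ.≤ j → j ℕ.< n → N + (N - ℕ→ℚ j) * e (suc j) ≤ N * e j) →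
                              0ℚ ≤ e n → 1ℚ + p * c ≤ c → Supersolution (potential e c)
    potential-supersolution _ step e-n≥0 _ (AB j true) (1≤j , j≤n) = by-cover (j ℕ.≟ n)
      where
      at-cover : bellman (potential e c) (AB n true) ≤ potential e c (AB n true)
      at-cover = begin
        bellman (potential e c) (AB n true)   ≡⟨ potential-bellman-covered n true refl ⟩
        0ℚ                                    ≤⟨ e-n≥0 ⟩
        e n                                   ≡⟨ cancel N (e n) ⟨
        N - N + e n                           ∎
        where
        open ≤-Reasoning
        cancel : ∀ N x → N - N + x ≡ x
        cancel = solve-∀ ℚ-ring
      by-cover : Dec (j ≡ n) → bellman (potential e c) (AB j true) ≤ potential e c (AB j true)
      by-cover (yes j≡n) = subst (λ i → bellman (potential e c) (AB i true) ≤ potential e c (AB i true)) (sym j≡n) at-cover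
      by-cover (no j≢n)  = ≤-trans (≤-reflexive (potential-bellman-AB j 1≤j j≢n))
                                   (+-monoʳ-≤ (N - ℕ→ℚ j) (p*-≤ (step j 1≤j (ℕ.≤∧≢⇒< j≤n j≢n))))
    potential-supersolution 1≤m _ _ start (AB _ false) refl =
      ≤-trans (≤-reflexive (potential-bellman-start (1≢n 1≤m))) (+-monoʳ-≤ (N - ℕ→ℚ 2 + e 2) start)
    potential-supersolution _ _ _ _ (Idle k)   valid = ≤-reflexive (potential-bellman-Idle k valid)
    potential-supersolution _ _ _ _ (Walk k l) valid = ≤-reflexive (potential-bellman-Walk k l valid)

    potential-subsolution : 1 ℕ.≤ m → (∀ j → 1 ℕ.≤ j → j ℕ.< n → N * e j ≤ N + (N - ℕ→ℚ j) * e (suc j)) →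
                            e n ≤ 0ℚ → c ≤ 1ℚ + p * c → Subsolution (potential e c)
    potential-subsolution _ step e-n≤0 _ (AB j true) (1≤j , j≤n) = by-cover (j ℕ.≟ n)
      where
      at-cover : potential e c (AB n true) ≤ bellman (potential e c) (AB n true)
      at-cover = begin
        N - N + e n                           ≡⟨ cancel N (e n) ⟩
        e n                                   ≤⟨ e-n≤0 ⟩
        0ℚ                                    ≡⟨ potential-bellman-covered n true refl ⟨
        bellman (potential e c) (AB n true)   ∎
        where
        open ≤-Reasoning
        cancel : ∀ N x → N - N + x ≡ x
        cancel = solve-∀ ℚ-ring
      by-cover : Dec (j ≡ n) → potential e c (AB j true) ≤ bellman (potential e c) (AB j true)
      by-cover (yes j≡n) = subst (λ i → potential e c (AB i true) ≤ bellman (potential e c) (AB i true)) (sym j≡n) at-cover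
      by-cover (no j≢n)  = ≤-trans (+-monoʳ-≤ (N - ℕ→ℚ j) (≤-p* (step j 1≤j (ℕ.≤∧≢⇒< j≤n j≢n))))
                                   (≤-reflexive (sym (potential-bellman-AB j 1≤j j≢n)))
    potential-subsolution 1≤m _ _ start (AB _ false) refl =
      ≤-trans (+-monoʳ-≤ (N - ℕ→ℚ 2 + e 2) start) (≤-reflexive (sym (potential-bellman-start (1≢n 1≤m))))
    potential-subsolution _ _ _ _ (Idle k)   valid = ≤-reflexive (sym (potential-bellman-Idle k valid))
    potential-subsolution _ _ _ _ (Walk k l) valid = ≤-reflexive (sym (potential-bellman-Walk k l valid))

    potential-nonNeg : 1 ℕ.≤ m → (∀ j → 0ℚ ≤ e j) → 0ℚ ≤ c → ∀ x → Valid x → 0ℚ ≤ potential e c x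
    potential-nonNeg _   e≥0 _   (AB j true)  (_ , j≤n)         = +-mono-≤ (N-nonNeg j≤n) (e≥0 j)
    potential-nonNeg 1≤m e≥0 c≥0 (AB _ false) refl              = +-mono-≤ (+-mono-≤ (N-nonNeg (s≤s 1≤m)) (e≥0 2)) c≥0
    potential-nonNeg _   _   _   (Idle k)     (_ , k≤n)         = idleCost-nonNeg k≤n
    potential-nonNeg _   _   _   (Walk k l)   (1≤k , _ , k+l≤n) = walkCost-nonNeg 1≤k k+l≤n

    potential-≤ : ∀ {E} → 0ℚ ≤ E → (∀ j → e j ≤ E) → c ≤ ℕ→ℚ 2 → ∀ x → Valid x → potential e c x ≤ N + E + (N + 1ℚ)
    potential-≤ {E} 0≤E e≤E c≤2 = bound
      where
      N≤N+E : N ≤ N + E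
      N≤N+E = ≤-by-slack E refl 0≤E
      N+E≤bound : N + E ≤ N + E + (N + 1ℚ)
      N+E≤bound = ≤-by-slack (N + 1ℚ) refl (+-mono-≤ (ℕ→ℚ-nonNeg n) (ℕ→ℚ-nonNeg 1))
      bound : ∀ x → Valid x → potential e c x ≤ N + E + (N + 1ℚ)
      bound (AB j true)  _    = ≤-trans (+-mono-≤ (p-q≤p N (ℕ→ℚ-nonNeg j)) (e≤E j)) N+E≤bound
      bound (AB _ false) refl = ≤-trans (≤-trans (+-mono-≤ (+-monoʳ-≤ (N - ℕ→ℚ 2) (e≤E 2)) c≤2) (≤-reflexive (cancel N (ℕ→ℚ 2) E))) N+E≤bound
        where
        cancel : ∀ N t E → N - t + E + t ≡ N + E
        cancel = solve-∀ ℚ-ring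
      bound (Idle (suc k)) (_ , k<n) = ≤-trans (idleCost-≤ k<n) (+-mono-≤ N≤N+E (≤-by-slack 1ℚ refl (ℕ→ℚ-nonNeg 1)))
      bound (Walk (suc k) l) (_ , _ , k+l≤n) = ≤-trans (walkCost-≤ {k} {l} (ℕ.≤-trans (ℕ.m≤m+n (suc k) l) k+l≤n)) (+-monoˡ-≤ (N + 1ℚ) N≤N+E)

  potential-mono : ∀ {e e′ c c′} → (∀ j → e j ≤ e′ j) → c ≤ c′ → ∀ x → potential e c x ≤ potential e′ c′ x
  potential-mono {e} {e′} e≤e′ c≤c′ (AB j true)  = +-monoʳ-≤ (N - ℕ→ℚ j) (e≤e′ j)
  potential-mono {e} {e′} e≤e′ c≤c′ (AB _ false) = +-mono-≤ (+-monoʳ-≤ (N - ℕ→ℚ 2) (e≤e′ 2)) c≤c′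
  potential-mono e≤e′ c≤c′ (Idle k)     = ≤-refl
  potential-mono e≤e′ c≤c′ (Walk k l)   = ≤-refl

  -- Bounds the number of uncounted moves still to come (detecting the cover time and
  -- choosing the start of each Wilson walk).
  uncounted : Lumped → ℚ
  uncounted (AB j _)   = N - ℕ→ℚ j + ℕ→ℚ 2
  uncounted (Idle k)   = N - ℕ→ℚ k + 1ℚ
  uncounted (Walk k _) = N - ℕ→ℚ k

  uncounted-nonNeg : ∀ x → Valid x → 0ℚ ≤ uncounted x
  uncounted-nonNeg (AB j b)   valid             = +-mono-≤ (N-nonNeg (Valid-AB⇒≤n b valid)) (ℕ→ℚ-nonNeg 2)
  uncounted-nonNeg (Idle k)   (_ , k≤n)         = +-mono-≤ (N-nonNeg k≤n) (ℕ→ℚ-nonNeg 1)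
  uncounted-nonNeg (Walk k l) (_ , _ , k+l≤n)   = N-nonNeg (ℕ.≤-trans (ℕ.m≤m+n k l) k+l≤n)

  uncounted-≤ : ∀ x → uncounted x ≤ N + ℕ→ℚ 2
  uncounted-≤ (AB j _)   = +-monoˡ-≤ (ℕ→ℚ 2) (p-q≤p N (ℕ→ℚ-nonNeg j))
  uncounted-≤ (Idle k)   = +-mono-≤ (p-q≤p N (ℕ→ℚ-nonNeg k)) (ℕ→ℚ-mono-≤ {1} {2} (s≤s z≤n))
  uncounted-≤ (Walk k _) = ≤-trans (p-q≤p N (ℕ→ℚ-nonNeg k)) (≤-by-slack (ℕ→ℚ 2) refl (ℕ→ℚ-nonNeg 2))

  uncounted-super : ∀ x → Valid x → 1ℚ - reward x + expect (moves x) uncounted ≤ uncounted x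
  uncounted-super (AB j b) valid = by-cover (j ℕ.≟ n)
    where
    J = ℕ→ℚ j
    u = N - J + ℕ→ℚ 2
    by-cover : Dec (j ≡ n) → 1ℚ - reward (AB j b) + expect (moves (AB j b)) uncounted ≤ u
    by-cover (yes j≡n) = ≤-reflexive (begin
      1ℚ - reward (AB j b) + expect (moves (AB j b)) uncounted
        ≡⟨ cong₂ (λ r ms → 1ℚ - r + expect ms uncounted) (reward-AB-covered b j≡n) (moves-AB-covered b j≡n) ⟩
      1ℚ - 0ℚ + expect ((1ℚ , Idle j) ∷ []) uncounted
        ≡⟨ last-uncounted N J ⟩
      u ∎)
      where
      open ≡-Reasoning
      last-uncounted : ∀ N J → 1ℚ - 0ℚ + (1ℚ * (N - J + 1ℚ) + 0ℚ) ≡ N - J + (1ℚ + 1ℚ)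
      last-uncounted = solve-∀ ℚ-ring
    by-cover (no j≢n) = begin
      1ℚ - reward (AB j b) + expect (moves (AB j b)) uncounted
        ≡⟨ cong₂ (λ r ms → 1ℚ - r + expect ms uncounted) (reward-AB b j≢n) (moves-AB b j≢n) ⟩
      1ℚ - 1ℚ + (p * J * uncounted (stay j b) + (p * (N - J) * uncounted (AB (suc j) true) + 0ℚ))
        ≤⟨ +-monoʳ-≤ (1ℚ - 1ℚ) (+-mono-≤ (*-monoˡ-≤-nonNeg′ (p*-nonNeg (ℕ→ℚ-nonNeg j)) (stay≤ b))
                                          (+-monoˡ-≤ 0ℚ (*-monoˡ-≤-nonNeg′ (p*-nonNeg (N-nonNeg (Valid-AB⇒≤n b valid))) next≤))) ⟩
      1ℚ - 1ℚ + (p * J * u + (p * (N - J) * u + 0ℚ))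
        ≡⟨ ≡-modulo-unit u pN≡1 (average p J N u) ⟩
      u ∎
      where
      open ≤-Reasoning
      stay≤ : ∀ b → uncounted (stay j b) ≤ u
      stay≤ true  = +-monoʳ-≤ (N - J) (ℕ→ℚ-mono-≤ {1} {2} (s≤s z≤n))
      stay≤ false = ≤-refl
      step-back : ∀ N J → N - (1ℚ + J) + 1ℚ ≡ N - J
      step-back = solve-∀ ℚ-ring
      next≤ : uncounted (AB (suc j) true) ≤ u
      next≤ = +-monoˡ-≤ (ℕ→ℚ 2) (≤-by-slack {N - ℕ→ℚ (suc j)} 1ℚ
                                  (sym (≡.trans (cong (λ x → N - x + 1ℚ) (ℕ→ℚ-suc j)) (step-back N J))) (ℕ→ℚ-nonNeg 1))
      average : ∀ p J N u → 1ℚ - 1ℚ + (p * J * u + (p * (N - J) * u + 0ℚ)) ≡ u + u * (p * N - 1ℚ)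
      average = solve-∀ ℚ-ring
  uncounted-super (Idle k) _ = by-cover (k ℕ.≟ n)
    where
    by-cover : Dec (k ≡ n) → 1ℚ - 0ℚ + expect (moves (Idle k)) uncounted ≤ N - ℕ→ℚ k + 1ℚ
    by-cover (yes k≡n) = ≤-reflexive (begin
      1ℚ - 0ℚ + expect (moves (Idle k)) uncounted  ≡⟨ cong (λ ms → 1ℚ - 0ℚ + expect ms uncounted) (moves-Idle-covered k≡n) ⟩
      1ℚ - 0ℚ + 0ℚ                                 ≡⟨ last-idle N ⟩
      N - N + 1ℚ                                   ≡⟨ cong (λ i → N - ℕ→ℚ i + 1ℚ) k≡n ⟨
      N - ℕ→ℚ k + 1ℚ                               ∎)
      where
      open ≡-Reasoning
      last-idle : ∀ N → 1ℚ - 0ℚ + 0ℚ ≡ N - N + 1ℚ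
      last-idle = solve-∀ ℚ-ring
    by-cover (no k≢n) = ≤-reflexive (begin
      1ℚ - 0ℚ + expect (moves (Idle k)) uncounted  ≡⟨ cong (λ ms → 1ℚ - 0ℚ + expect ms uncounted) (moves-Idle k≢n) ⟩
      1ℚ - 0ℚ + (1ℚ * (N - ℕ→ℚ k) + 0ℚ)            ≡⟨ start-walk N (ℕ→ℚ k) ⟩
      N - ℕ→ℚ k + 1ℚ                               ∎)
      where
      open ≡-Reasoning
      start-walk : ∀ N K → 1ℚ - 0ℚ + (1ℚ * (N - K) + 0ℚ) ≡ N - K + 1ℚ
      start-walk = solve-∀ ℚ-ring
  uncounted-super (Walk k l) (_ , 1≤l , _) = begin
    1ℚ - 1ℚ + (p * K * (N - ℕ→ℚ (k ℕ.+ l) + 1ℚ) + (p * (N - K - L) * (N - K) + expect (loopBacks k l) uncounted))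
      ≡⟨ cong₂ (λ A E → 1ℚ - 1ℚ + (p * K * (N - A + 1ℚ) + (p * (N - K - L) * (N - K) + E)))
               (ℕ→ℚ-homo-+ k l) (≡.trans (expect-loopBacks uncounted k l) (cong (p *_) (sumTo-const (N - K) l))) ⟩
    1ℚ - 1ℚ + (p * K * (N - (K + L) + 1ℚ) + (p * (N - K - L) * (N - K) + p * (L * (N - K))))
      ≤⟨ ≤-by-slack (p * (K * (L - 1ℚ))) (≡-modulo-unit (- (N - K)) pN≡1 (expand p K L N))
                    (p*-nonNeg (*-nonNeg (ℕ→ℚ-nonNeg k) (p≤q⇒0≤q-p (ℕ→ℚ-mono-≤ 1≤l)))) ⟩
    N - K ∎
    where
    open ≤-Reasoning
    K = ℕ→ℚ k
    L = ℕ→ℚ l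
    expand : ∀ p K L N → N - K ≡ 1ℚ - 1ℚ + (p * K * (N - (K + L) + 1ℚ) + (p * (N - K - L) * (N - K) + p * (L * (N - K))))
                                 + p * (K * (L - 1ℚ)) + (- (N - K)) * (p * N - 1ℚ)
    expand = solve-∀ ℚ-ring

Etrunc-init : ∀ m T (r : Fin (suc m)) → Etrunc m T (init r) ≡ LumpedChain.value m T (AB 1 false)
Etrunc-init m T r = ≡.trans (LumpedChain.lumping m T (init r) tt) (cong (λ j → LumpedChain.value m T (AB j false)) (∣⁅x⁆∣≡1 r))

-- Estimates for N = n with s² ≤ n ≤ s² + 2s

module Estimates (m s : ℕ) (1≤m : 1 ℕ.≤ m) (s²≤n : s ℕ.* s ℕ.≤ suc m) (n≤s²+2s : suc m ℕ.≤ s ℕ.* s ℕ.+ 2 ℕ.* s) where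

  open LumpedChain m

  upper lower : ℕ → ℚ
  upper j = ℕ→ℚ (upperExcess s j)
  lower j = ℕ→ℚ (lowerExcess s j) * ½

  U L Φ : Lumped → ℚ
  U = potential upper (ℕ→ℚ 2)
  L = potential lower 1ℚ
  Φ x = U x + uncounted x

  M : ℕ
  M = n ℕ.+ upperExcess s 0 ℕ.+ (n ℕ.+ 1) ℕ.+ (n ℕ.+ 2)

  ℕ→ℚ-affine : ∀ {j} a h → j ℕ.≤ n → ℕ→ℚ (a ℕ.+ (n ℕ.∸ j) ℕ.* h) ≡ ℕ→ℚ a + (N - ℕ→ℚ j) * ℕ→ℚ h
  ℕ→ℚ-affine {j} a h j≤n = ≡.trans (ℕ→ℚ-homo-+ a ((n ℕ.∸ j) ℕ.* h))
                                   (cong (ℕ→ℚ a +_) (≡.trans (ℕ→ℚ-homo-* (n ℕ.∸ j) h) (cong (_* ℕ→ℚ h) (ℕ→ℚ-homo-∸ j≤n))))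

  s≤n : s ℕ.≤ n
  s≤n = ℕ.≤-trans (m≤m*m s) s²≤n

  U-super : Supersolution U
  U-super = potential-supersolution upper (ℕ→ℚ 2) 1≤m step (ℕ→ℚ-nonNeg (upperExcess s n)) start
    where
    step : ∀ j → 1 ℕ.≤ j → j ℕ.< n → N + (N - ℕ→ℚ j) * upper (suc j) ≤ N * upper j
    step j _ j<n = subst₂ _≤_ (ℕ→ℚ-affine n (upperExcess s (suc j)) (ℕ.<⇒≤ j<n)) (ℕ→ℚ-homo-* n (upperExcess s j))
                          (ℕ→ℚ-mono-≤ (upperExcess-step {s = s} j n≤s²+2s (ℕ.<⇒≤ j<n)))
    start : 1ℚ + p * ℕ→ℚ 2 ≤ ℕ→ℚ 2
    start = +-monoʳ-≤ 1ℚ (p*-≤ (≤-trans (ℕ→ℚ-mono-≤ (s≤s 1≤m)) (≤-reflexive (sym (*-identityʳ N)))))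

  L-sub : Subsolution L
  L-sub = potential-subsolution lower 1ℚ 1≤m step lower-n≤0 (≤-by-slack (p * 1ℚ) refl (p*-nonNeg (ℕ→ℚ-nonNeg 1)))
    where
    step : ∀ j → 1 ℕ.≤ j → j ℕ.< n → N * lower j ≤ N + (N - ℕ→ℚ j) * lower (suc j)
    step j _ j<n = subst₂ _≤_ (halve-left ½ N Λ) (≡-modulo-unit N ½-inverseˡ (halve-right ½ (ℕ→ℚ 2) N (ℕ→ℚ j) Λ′))
                          (*-monoˡ-≤-nonNeg′ ½-nonNeg
                            (subst₂ _≤_ (ℕ→ℚ-homo-* n (lowerExcess s j))
                                        (≡.trans (ℕ→ℚ-affine (2 ℕ.* n) (lowerExcess s (suc j)) (ℕ.<⇒≤ j<n))
                                                 (cong (_+ (N - ℕ→ℚ j) * Λ′) (ℕ→ℚ-homo-* 2 n)))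
                                    (ℕ→ℚ-mono-≤ (lowerExcess-step {n} {s} j s²≤n))))
      where
      Λ = ℕ→ℚ (lowerExcess s j)
      Λ′ = ℕ→ℚ (lowerExcess s (suc j))
      halve-left : ∀ h N Λ → h * (N * Λ) ≡ N * (Λ * h)
      halve-left = solve-∀ ℚ-ring
      halve-right : ∀ h t N J Λ → h * (t * N + (N - J) * Λ) ≡ N + (N - J) * (Λ * h) + N * (h * t - 1ℚ)
      halve-right = solve-∀ ℚ-ring
    lower-n≤0 : lower n ≤ 0ℚ
    lower-n≤0 = ≤-reflexive (≡.trans (cong (λ d → ℕ→ℚ d * ½) (ℕ.m≤n⇒m∸n≡0 s≤n)) (*-zeroˡ ½))

  U-nonNeg : ∀ x → Valid x → 0ℚ ≤ U x
  U-nonNeg = potential-nonNeg upper (ℕ→ℚ 2) 1≤m (λ j → ℕ→ℚ-nonNeg (upperExcess s j)) (ℕ→ℚ-nonNeg 2)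

  upper≤upper0 : ∀ j → upper j ≤ upper 0
  upper≤upper0 j = ℕ→ℚ-mono-≤ {upperExcess s j} {upperExcess s 0} (ℕ.+-monoʳ-≤ (s ℕ.+ 2) (ℕ.m∸n≤m (2 ℕ.* s) j))

  ℕ→ℚ-M : ℕ→ℚ M ≡ N + upper 0 + (N + 1ℚ) + (N + ℕ→ℚ 2)
  ℕ→ℚ-M = begin
    ℕ→ℚ (n ℕ.+ upperExcess s 0 ℕ.+ (n ℕ.+ 1) ℕ.+ (n ℕ.+ 2))
      ≡⟨ ℕ→ℚ-homo-+ (n ℕ.+ upperExcess s 0 ℕ.+ (n ℕ.+ 1)) (n ℕ.+ 2) ⟩
    ℕ→ℚ (n ℕ.+ upperExcess s 0 ℕ.+ (n ℕ.+ 1)) + ℕ→ℚ (n ℕ.+ 2)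
      ≡⟨ cong (_+ ℕ→ℚ (n ℕ.+ 2)) (ℕ→ℚ-homo-+ (n ℕ.+ upperExcess s 0) (n ℕ.+ 1)) ⟩
    ℕ→ℚ (n ℕ.+ upperExcess s 0) + ℕ→ℚ (n ℕ.+ 1) + ℕ→ℚ (n ℕ.+ 2)
      ≡⟨ cong₂ (λ a b → a + b + ℕ→ℚ (n ℕ.+ 2)) (ℕ→ℚ-homo-+ n (upperExcess s 0)) (ℕ→ℚ-homo-+ n 1) ⟩
    N + upper 0 + (N + 1ℚ) + ℕ→ℚ (n ℕ.+ 2)
      ≡⟨ cong (N + upper 0 + (N + 1ℚ) +_) (ℕ→ℚ-homo-+ n 2) ⟩
    N + upper 0 + (N + 1ℚ) + (N + ℕ→ℚ 2) ∎
    where open ≡-Reasoning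

  Φ-bounded : ∀ x → Valid x → Φ x ≤ ℕ→ℚ M
  Φ-bounded x valid = begin
    U x + uncounted x                    ≤⟨ +-mono-≤ (potential-≤ upper (ℕ→ℚ 2) (ℕ→ℚ-nonNeg (upperExcess s 0)) upper≤upper0 ≤-refl x valid)
                                                     (uncounted-≤ x) ⟩
    N + upper 0 + (N + 1ℚ) + (N + ℕ→ℚ 2) ≡⟨ ℕ→ℚ-M ⟨
    ℕ→ℚ M                                ∎
    where open ≤-Reasoning

  Φ-lyapunov : Lyapunov Φ M
  Φ-lyapunov = record
    { drift   = supersolution-+ U-super uncounted-super
    ; bounded = Φ-bounded
    }

  L≤Φ : ∀ x → Valid x → L x ≤ Φ x
  L≤Φ x valid = begin
    L x                   ≤⟨ potential-mono {lower} {upper} {1ℚ} {ℕ→ℚ 2} lower≤upper 1≤2 x ⟩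
    U x                   ≤⟨ ≤-by-slack (uncounted x) refl (uncounted-nonNeg x valid) ⟩
    U x + uncounted x     ∎
    where
    open ≤-Reasoning
    1≤2 : 1ℚ ≤ ℕ→ℚ 2
    1≤2 = ℕ→ℚ-mono-≤ {1} {2} (s≤s z≤n)
    lower≤upper : ∀ j → lower j ≤ upper j
    lower≤upper j = begin
      ℕ→ℚ (lowerExcess s j) * ½     ≤⟨ *-monoˡ-≤-nonNeg′ (ℕ→ℚ-nonNeg (lowerExcess s j)) ½-≤-1 ⟩
      ℕ→ℚ (lowerExcess s j) * 1ℚ    ≡⟨ *-identityʳ (ℕ→ℚ (lowerExcess s j)) ⟩
      ℕ→ℚ (lowerExcess s j)         ≤⟨ ℕ→ℚ-mono-≤ {lowerExcess s j} {upperExcess s j} lowerExcess≤upperExcess ⟩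
      ℕ→ℚ (upperExcess s j)         ∎
      where
      lowerExcess≤upperExcess : lowerExcess s j ℕ.≤ upperExcess s j
      lowerExcess≤upperExcess = ℕ.≤-trans (ℕ.m∸n≤m s j) (ℕ.≤-trans (ℕ.m≤m+n s 2) (ℕ.m≤m+n (s ℕ.+ 2) (2 ℕ.* s ℕ.∸ j)))

  value≤N+upper : ∀ T → value T (AB 1 false) ≤ N + upper 2
  value≤N+upper T = begin
    value T (AB 1 false)     ≤⟨ value≤supersolution U-nonNeg U-super T (AB 1 false) refl ⟩
    U (AB 1 false)           ≡⟨ cancel N (ℕ→ℚ 2) (upper 2) ⟩
    N + upper 2              ∎
    where
    open ≤-Reasoning
    cancel : ∀ N t E → N - t + E + t ≡ N + E
    cancel = solve-∀ ℚ-ring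

  T* : ℕ
  T* = M ℕ.* M

  N+lower≤value : N + lower 2 - ℕ→ℚ 2 ≤ value T* (AB 1 false)
  N+lower≤value = begin
    N + lower 2 - ℕ→ℚ 2                                  ≡⟨ regroup N (ℕ→ℚ 2) (lower 2) ⟩
    L (AB 1 false) - 1ℚ
      ≤⟨ sub-mono-≤ (≤-refl {L (AB 1 false)}) (decay-≤-1 M T* ℕ.≤-refl (Φ-bounded (AB 1 false) refl)) ⟩
    L (AB 1 false) - decay M T* * Φ (AB 1 false)         ≤⟨ subsolution-decay≤value L-sub Φ-lyapunov L≤Φ T* (AB 1 false) refl ⟩
    value T* (AB 1 false)                                ∎
    where
    open ≤-Reasoning
    regroup : ∀ N t E → N + E - t ≡ N - t + E + 1ℚ - 1ℚ
    regroup = solve-∀ ℚ-ring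

module Asymptotics (m : ℕ) (143≤m : 143 ℕ.≤ m) where

  s : ℕ
  s = proj₁ (floor-sqrt (suc m))

  s²≤n : s ℕ.* s ℕ.≤ suc m
  s²≤n = proj₁ (proj₂ (floor-sqrt (suc m)))

  n<[s+1]² : suc m ℕ.< suc s ℕ.* suc s
  n<[s+1]² = proj₂ (proj₂ (floor-sqrt (suc m)))

  n≤s²+2s : suc m ℕ.≤ s ℕ.* s ℕ.+ 2 ℕ.* s
  n≤s²+2s = ℕ.≤-pred (subst (suc (suc m) ℕ.≤_) (square-suc s) n<[s+1]²)
    where
    square-suc : ∀ s → suc s ℕ.* suc s ≡ suc (s ℕ.* s ℕ.+ 2 ℕ.* s)
    square-suc = ℕ-Solver.solve-∀

  12≤s : 12 ℕ.≤ s
  12≤s with 12 ℕ.≤? s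
  ... | yes 12≤s = 12≤s
  ... | no  12≰s = ⊥-elim (ℕ.<-irrefl refl (ℕ.≤-trans (s≤s (s≤s 143≤m)) (ℕ.≤-trans n<[s+1]² (ℕ.*-mono-≤ s<12 s<12))))
    where
    s<12 : suc s ℕ.≤ 12
    s<12 = ℕ.≰⇒> 12≰s

  open LumpedChain m using (N) public
  open Estimates m s (ℕ.≤-trans (s≤s z≤n) 143≤m) s²≤n n≤s²+2s public

  upperExcess-2 : upperExcess s 2 ≡ 3 ℕ.* s
  upperExcess-2 = begin
    s ℕ.+ 2 ℕ.+ (2 ℕ.* s ℕ.∸ 2)     ≡⟨ ℕ.+-assoc s 2 (2 ℕ.* s ℕ.∸ 2) ⟩
    s ℕ.+ (2 ℕ.+ (2 ℕ.* s ℕ.∸ 2))   ≡⟨ cong (s ℕ.+_) (ℕ.m+[n∸m]≡n 2≤2s) ⟩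
    s ℕ.+ 2 ℕ.* s                   ≡⟨ triple s ⟩
    3 ℕ.* s                         ∎
    where
    open ≡-Reasoning
    2≤2s : 2 ℕ.≤ 2 ℕ.* s
    2≤2s = ℕ.≤-trans (ℕ.≤-trans (s≤s (s≤s z≤n)) 12≤s) (ℕ.m≤n*m s 2)
    triple : ∀ s → s ℕ.+ 2 ℕ.* s ≡ 3 ℕ.* s
    triple = ℕ-Solver.solve-∀

  s∸2≡s∸6+4 : s ℕ.∸ 2 ≡ s ℕ.∸ 6 ℕ.+ 2 ℕ.* 2
  s∸2≡s∸6+4 = subst (λ t → t ℕ.∸ 2 ≡ t ℕ.∸ 6 ℕ.+ 2 ℕ.* 2) (ℕ.m+[n∸m]≡n 12≤s) (shift (s ℕ.∸ 12))
    where
    shift : ∀ a → 10 ℕ.+ a ≡ 6 ℕ.+ a ℕ.+ 2 ℕ.* 2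
    shift = ℕ-Solver.solve-∀

  n≤16[s∸6]² : suc m ℕ.≤ 2 ℕ.* 2 ℕ.* (2 ℕ.* 2) ℕ.* ((s ℕ.∸ 6) ℕ.* (s ℕ.∸ 6))
  n≤16[s∸6]² = subst (λ t → suc m ℕ.≤ 2 ℕ.* 2 ℕ.* (2 ℕ.* 2) ℕ.* ((t ℕ.∸ 6) ℕ.* (t ℕ.∸ 6))) (ℕ.m+[n∸m]≡n 12≤s)
    (ℕ.≤-trans (subst (λ t → suc m ℕ.≤ t ℕ.* t ℕ.+ 2 ℕ.* t) (sym (ℕ.m+[n∸m]≡n 12≤s)) n≤s²+2s)
               (ℕ.≤-trans (ℕ.m≤m+n _ _) (ℕ.≤-reflexive (expand (s ℕ.∸ 12)))))
    where
    expand : ∀ a → (12 ℕ.+ a) ℕ.* (12 ℕ.+ a) ℕ.+ 2 ℕ.* (12 ℕ.+ a) ℕ.+ (408 ℕ.+ 166 ℕ.* a ℕ.+ 15 ℕ.* (a ℕ.* a))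
                   ≡ 2 ℕ.* 2 ℕ.* (2 ℕ.* 2) ℕ.* ((6 ℕ.+ a) ℕ.* (6 ℕ.+ a))
    expand = ℕ-Solver.solve-∀

  excess-upper : ∀ (r : Fin (suc m)) T → LeCSqrt (Etrunc m T (init r) - ℕ→ℚ (suc m)) (ℕ→ℚ 3) (suc m)
  excess-upper r T = by-sign (≤-total x 0ℚ)
    where
    x = Etrunc m T (init r) - ℕ→ℚ (suc m)
    x≤3s : x ≤ ℕ→ℚ (3 ℕ.* s)
    x≤3s = a≤b+c⇒a-b≤c {Etrunc m T (init r)} {ℕ→ℚ (suc m)} {ℕ→ℚ (3 ℕ.* s)} (≤-trans (≤-reflexive (Etrunc-init m T r))
                                (≤-trans (value≤N+upper T) (≤-reflexive (cong (λ e → N + ℕ→ℚ e) upperExcess-2))))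
    squares : ∀ s → 3 ℕ.* s ℕ.* (3 ℕ.* s) ≡ 3 ℕ.* 3 ℕ.* (s ℕ.* s)
    squares = ℕ-Solver.solve-∀
    9s²≤9n : 3 ℕ.* s ℕ.* (3 ℕ.* s) ℕ.≤ 3 ℕ.* 3 ℕ.* suc m
    9s²≤9n = ℕ.≤-trans (ℕ.≤-reflexive (squares s)) (ℕ.*-monoʳ-≤ (3 ℕ.* 3) s²≤n)
    by-sign : x ≤ 0ℚ ⊎ 0ℚ ≤ x → LeCSqrt x (ℕ→ℚ 3) (suc m)
    by-sign (inj₁ x≤0) = inj₁ x≤0
    by-sign (inj₂ 0≤x) = inj₂ (begin
      x * x                                ≤⟨ square-mono-≤ 0≤x x≤3s ⟩
      ℕ→ℚ (3 ℕ.* s) * ℕ→ℚ (3 ℕ.* s)        ≡⟨ ℕ→ℚ-homo-* (3 ℕ.* s) (3 ℕ.* s) ⟨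
      ℕ→ℚ (3 ℕ.* s ℕ.* (3 ℕ.* s))          ≤⟨ ℕ→ℚ-mono-≤ {3 ℕ.* s ℕ.* (3 ℕ.* s)} {3 ℕ.* 3 ℕ.* suc m} 9s²≤9n ⟩
      ℕ→ℚ (3 ℕ.* 3 ℕ.* suc m)              ≡⟨ ℕ→ℚ-homo-* (3 ℕ.* 3) (suc m) ⟩
      ℕ→ℚ (3 ℕ.* 3) * ℕ→ℚ (suc m)          ≡⟨ cong (_* ℕ→ℚ (suc m)) (ℕ→ℚ-homo-* 3 3) ⟩
      ℕ→ℚ 3 * ℕ→ℚ 3 * ℕ→ℚ (suc m)          ∎)
      where open ≤-Reasoning

excess-lower : ∀ m → 143 ℕ.≤ m → (r : Fin (suc m)) → ∀ c → 0ℚ ≤ c → c ≤ ½ * ½ * ½ →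
               ∃ λ T → GeCSqrt (Etrunc m T (init r) - ℕ→ℚ (suc m)) c (suc m)
excess-lower m 143≤m r c 0≤c c≤½³ = T* , witness
  where
  open Asymptotics m 143≤m
  open ≤-Reasoning
  K = ℕ→ℚ (s ℕ.∸ 6)
  Kh≥0 : 0ℚ ≤ K * ½
  Kh≥0 = *-nonNeg (ℕ→ℚ-nonNeg (s ℕ.∸ 6)) ½-nonNeg
  c²≥0 : 0ℚ ≤ ½ * ½ * ½ * (½ * ½ * ½)
  c²≥0 = *-nonNeg c≥0 c≥0
    where
    c≥0 : 0ℚ ≤ ½ * ½ * ½
    c≥0 = *-nonNeg (*-nonNeg ½-nonNeg ½-nonNeg) ½-nonNeg
  collapse : ∀ h t K → h * t ≡ 1ℚ → h * h * h * (h * h * h) * (t * t * (t * t) * (K * K)) ≡ K * h * (K * h)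
  collapse h t K ht≡1 = ≡-modulo-unit (h * h * K * K * (h * t + 1ℚ) * (h * h * t * t + 1ℚ)) ht≡1 (expand h t K)
    where
    expand : ∀ h t K → h * h * h * (h * h * h) * (t * t * (t * t) * (K * K))
                       ≡ K * h * (K * h) + h * h * K * K * (h * t + 1ℚ) * (h * h * t * t + 1ℚ) * (h * t - 1ℚ)
    expand = solve-∀ ℚ-ring
  n≤16K² : ℕ→ℚ (suc m) ≤ ℕ→ℚ 2 * ℕ→ℚ 2 * (ℕ→ℚ 2 * ℕ→ℚ 2) * (K * K)
  n≤16K² = begin
    ℕ→ℚ (suc m)
      ≤⟨ ℕ→ℚ-mono-≤ {suc m} {2 ℕ.* 2 ℕ.* (2 ℕ.* 2) ℕ.* ((s ℕ.∸ 6) ℕ.* (s ℕ.∸ 6))} n≤16[s∸6]² ⟩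
    ℕ→ℚ (2 ℕ.* 2 ℕ.* (2 ℕ.* 2) ℕ.* ((s ℕ.∸ 6) ℕ.* (s ℕ.∸ 6)))
      ≡⟨ ℕ→ℚ-homo-* (2 ℕ.* 2 ℕ.* (2 ℕ.* 2)) ((s ℕ.∸ 6) ℕ.* (s ℕ.∸ 6)) ⟩
    ℕ→ℚ (2 ℕ.* 2 ℕ.* (2 ℕ.* 2)) * ℕ→ℚ ((s ℕ.∸ 6) ℕ.* (s ℕ.∸ 6))
      ≡⟨ cong₂ _*_ (≡.trans (ℕ→ℚ-homo-* (2 ℕ.* 2) (2 ℕ.* 2)) (cong₂ _*_ (ℕ→ℚ-homo-* 2 2) (ℕ→ℚ-homo-* 2 2)))
                   (ℕ→ℚ-homo-* (s ℕ.∸ 6) (s ℕ.∸ 6)) ⟩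
    ℕ→ℚ 2 * ℕ→ℚ 2 * (ℕ→ℚ 2 * ℕ→ℚ 2) * (K * K) ∎
  Kh≤x : K * ½ ≤ Etrunc m T* (init r) - ℕ→ℚ (suc m)
  Kh≤x = begin
    K * ½
      ≡⟨ ≡-modulo-unit (ℕ→ℚ 2) ½-inverseˡ (expand K (ℕ→ℚ 2) ½) ⟨
    (K + ℕ→ℚ 2 * ℕ→ℚ 2) * ½ - ℕ→ℚ 2
      ≡⟨ cong (λ d → d * ½ - ℕ→ℚ 2) s∸2≡K+4 ⟨
    lower 2 - ℕ→ℚ 2
      ≤⟨ a+b≤c⇒b≤c-a {ℕ→ℚ (suc m)} {lower 2 - ℕ→ℚ 2} {Etrunc m T* (init r)} (≤-trans (≤-reflexive (sym (+-assoc N (lower 2) (- ℕ→ℚ 2))))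
                              (≤-trans N+lower≤value (≤-reflexive (sym (Etrunc-init m T* r))))) ⟩
    Etrunc m T* (init r) - ℕ→ℚ (suc m) ∎
    where
    s∸2≡K+4 : ℕ→ℚ (s ℕ.∸ 2) ≡ K + ℕ→ℚ 2 * ℕ→ℚ 2
    s∸2≡K+4 = ≡.trans (cong ℕ→ℚ s∸2≡s∸6+4) (≡.trans (ℕ→ℚ-homo-+ (s ℕ.∸ 6) (2 ℕ.* 2)) (cong (K +_) (ℕ→ℚ-homo-* 2 2)))
    expand : ∀ K t h → (K + t * t) * h - t ≡ K * h + t * (h * t - 1ℚ)
    expand = solve-∀ ℚ-ring
  0≤x : 0ℚ ≤ Etrunc m T* (init r) - ℕ→ℚ (suc m)
  0≤x = ≤-trans Kh≥0 Kh≤x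
  lowerSquare : ½ * ½ * ½ * (½ * ½ * ½) * ℕ→ℚ (suc m) ≤ (Etrunc m T* (init r) - ℕ→ℚ (suc m)) * (Etrunc m T* (init r) - ℕ→ℚ (suc m))
  lowerSquare = begin
    ½ * ½ * ½ * (½ * ½ * ½) * ℕ→ℚ (suc m)
      ≤⟨ *-monoˡ-≤-nonNeg′ c²≥0 n≤16K² ⟩
    ½ * ½ * ½ * (½ * ½ * ½) * (ℕ→ℚ 2 * ℕ→ℚ 2 * (ℕ→ℚ 2 * ℕ→ℚ 2) * (K * K))
      ≡⟨ collapse ½ (ℕ→ℚ 2) K ½-inverseˡ ⟩
    K * ½ * (K * ½)
      ≤⟨ square-mono-≤ Kh≥0 Kh≤x ⟩
    (Etrunc m T* (init r) - ℕ→ℚ (suc m)) * (Etrunc m T* (init r) - ℕ→ℚ (suc m)) ∎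
  c-bound : c * c * ℕ→ℚ (suc m) ≤ (Etrunc m T* (init r) - ℕ→ℚ (suc m)) * (Etrunc m T* (init r) - ℕ→ℚ (suc m))
  c-bound = ≤-trans (*-monoʳ-≤-nonNeg (ℕ→ℚ (suc m)) {{nonNegative (ℕ→ℚ-nonNeg (suc m))}} (square-mono-≤ 0≤c c≤½³)) lowerSquare
  witness : GeCSqrt (Etrunc m T* (init r) - ℕ→ℚ (suc m)) c (suc m)
  witness = 0≤x , c-bound

½³-pos : 0ℚ < ½ * ½ * ½
½³-pos = *-pos {½ * ½} {½} (*-pos {½} {½} ½-pos ½-pos) ½-pos

proposition2 : Σ ℚ λ c₁ → Σ ℚ λ c₂ → (0ℚ < c₁) × (0ℚ < c₂) × Σ ℕ λ N →
    ∀ m → m ≥ N → (r : Fin (suc m)) →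
    (∀ T → LeCSqrt (Etrunc m T (init r) - ℕ→ℚ (suc m)) c₂ (suc m))
    × (∃ λ T → GeCSqrt (Etrunc m T (init r) - ℕ→ℚ (suc m)) c₁ (suc m))
proposition2 = ½ * ½ * ½ , ℕ→ℚ 3 , ½³-pos , ℕ→ℚ-pos 2 , 143 ,
               λ m m≥143 r → Asymptotics.excess-upper m m≥143 r , excess-lower m m≥143 r (½ * ½ * ½) (<⇒≤ ½³-pos) ≤-refl
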